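{- Let $n\ge 1$, let $\mathcal{T}_n$ be the set of CNATs of size $n$, and let $\mathcal{A}_n\subseteq\mathcal{T}_n$ be the set of those all of whose leaves are short. The map $\Phi:\mathcal{T}_n\to\mathcal{T}_n$ defined below is an involution, and for every $T\in\mathcal{T}_n\setminus\mathcal{A}_n$ one has $\operatorname{sgn}\pi(\Phi(T))=-\operatorname{sgn}\pi(T)$.
   Context: A non-ambiguous tree (NAT) is a filling of a rectangular grid in which each cell is dotted or not, such that: the top-left cell is dotted (the root); every dotted cell other than the root has either a dotted cell above it in the same column or a dotted cell to its left in the same row, but not both; and every row and every column contains at least one dotted cell. Each non-root dot has a parent: the nearest dot above it in its column, or the nearest dot to its left in its row. A complete non-ambiguous tree (CNAT) is a NAT in which every dot either has both a dot below it in its column and a dot to its right in its row (an internal dot), or neither (a leaf). The size $n$ of a CNAT is its number of leaves; a CNAT of size $n$ has rows and columns labelled $1,\dots,n$ from top to bottom and from left to right, and each row and each column contains exactly one leaf. $r(d)$ and $c(d)$ denote the row and column of a dot $d$. The associated permutation $\pi(T)$ is given by $\pi(T)(i)=j$ iff the leaf in column $i$ lies in row $j$. A leaf is short if its parent lies in a cell adjacent to it, and long otherwise. A leaf is a left leaf if it lies in the same column as its parent, and a right leaf if it lies in the same row as its parent. Two left leaves $l_1,l_2$ with parents $p_1,p_2$ are interacting if $r(p_1)<r(l_2)<r(l_1)$ or $r(p_2)<r(l_1)<r(l_2)$; two right leaves are interacting if $c(p_1)<c(l_2)<c(l_1)$ or $c(p_2)<c(l_1)<c(l_2)$. For two interacting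 left leaves, the switch $S(T,l_1,l_2)$ replaces $l_1,l_2$ by a dot in column $c(l_1)$, row $r(l_2)$ and a dot in column $c(l_2)$, row $r(l_1)$ (exchanging their row labels); for interacting right leaves it exchanges their column labels analogously. The switch of two interacting leaves of a CNAT of size $n$ is again a CNAT of size $n$. Definition of $\Phi$: if $T\in\mathcal{A}_n$, set $\Phi(T)=T$. Otherwise $T$ has a long leaf, and every CNAT with a long leaf has a pair of interacting leaves. If $T$ has a pair of interacting left leaves, let $(l_1,l_2)$ be the ordered pair of interacting left leaves for which $(r(l_1),r(l_2))$ is lexicographically maximal, and set $\Phi(T)=S(T,l_1,l_2)$. If $T$ has no interacting left leaves (hence has interacting right leaves), let $(l_1,l_2)$ be the ordered pair of interacting right leaves for which $(c(l_1),c(l_2))$ is lexicographically maximal, and set $\Phi(T)=S(T,l_1,l_2)$. -}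

module Defs where

open import Data.Bool using (Bool; true; false; _∧_; _∨_; not; if_then_else_; _xor_)
open import Data.Nat using (ℕ; zero; suc; _+_; _<ᵇ_; _≡ᵇ_; _%_)
open import Data.Fin using (Fin; toℕ) renaming (zero to fzero; suc to fsuc)
open import Data.Maybe using (Maybe; just; nothing; _<∣>_; fromMaybe)
open import Data.Product using (_×_; _,_; ∃-syntax)
open import Data.Integer using (ℤ; 1ℤ; -1ℤ)
open import Relation.Binary.PropositionalEquality using (_≡_)
open import Data.Empty using (⊥)

anyF : ∀ {n} → (Fin n → Bool) → Bool
anyF {zero}  f = false
anyF {suc n} f = f fzero ∨ anyF (λ i → f (fsuc i))

allF : ∀ {n} → (Fin n → Bool) → Bool
allF {zero}  f = true
allF {suc n} f = f fzero ∧ allF (λ i → f (fsuc i))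

sumF : ∀ {n} → (Fin n → ℕ) → ℕ
sumF {zero}  f = 0
sumF {suc n} f = f fzero + sumF (λ i → f (fsuc i))

findLast : ∀ {n} {A : Set} → (Fin n → Maybe A) → Maybe A
findLast {zero}  f = nothing
findLast {suc n} f = findLast (λ i → f (fsuc i)) <∣> f fzero

_<ᶠ_ : ∀ {n} → Fin n → Fin n → Bool
i <ᶠ j = toℕ i <ᵇ toℕ j

_≡ᶠ_ : ∀ {n} → Fin n → Fin n → Bool
i ≡ᶠ j = toℕ i ≡ᵇ toℕ j

-- Fillings of the n × n grid.  T r c = true  iff cell (row r, column c)
-- is dotted.  Rows are numbered top to bottom, columns left to right,
-- starting from 0 (the paper's 1..n).

Grid : ℕ → Set
Grid n = Fin n → Fin n → Bool

Cell : ℕ → Set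
Cell n = Fin n × Fin n      -- (row , column)

module _ {n : ℕ} (T : Grid n) where

  dotAbove dotBelow dotLeft dotRight : Fin n → Fin n → Bool
  dotAbove r c = anyF (λ r' → (r' <ᶠ r) ∧ T r' c)
  dotBelow r c = anyF (λ r' → (r <ᶠ r') ∧ T r' c)
  dotLeft  r c = anyF (λ c' → (c' <ᶠ c) ∧ T r c')
  dotRight r c = anyF (λ c' → (c <ᶠ c') ∧ T r c')

  isLeaf : Fin n → Fin n → Bool
  isLeaf r c = T r c ∧ not (dotBelow r c) ∧ not (dotRight r c)

  -- left leaf: lies in the same column as its parent (i.e. has a dot above)
  isLeftLeaf : Fin n → Fin n → Bool
  isLeftLeaf r c = isLeaf r c ∧ dotAbove r c

  -- right leaf: lies in the same row as its parent (i.e. has a dot to its left)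
  isRightLeaf : Fin n → Fin n → Bool
  isRightLeaf r c = isLeaf r c ∧ dotLeft r c

  parentRow : Fin n → Fin n → Maybe (Fin n)
  parentRow r c = findLast (λ r' → if (r' <ᶠ r) ∧ T r' c then just r' else nothing)

  parentCol : Fin n → Fin n → Maybe (Fin n)
  parentCol r c = findLast (λ c' → if (c' <ᶠ c) ∧ T r c' then just c' else nothing)

  adjacent : Maybe (Fin n) → Fin n → Bool
  adjacent (just p) x = suc (toℕ p) ≡ᵇ toℕ x
  adjacent nothing  x = false

  -- a leaf is short if its parent is in an adjacent cell; the root (which
  -- has no parent) is never long
  isShortLeaf : Fin n → Fin n → Bool
  isShortLeaf r c =
    if isLeftLeaf r c then adjacent (parentRow r c) r
    else if isRightLeaf r c then adjacent (parentCol r c) c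
    else true

  allShort : Bool
  allShort = allF (λ r → allF (λ c → not (isLeaf r c) ∨ isShortLeaf r c))

  between : Maybe (Fin n) → Fin n → Fin n → Bool
  between (just p) x y = (p <ᶠ x) ∧ (x <ᶠ y)
  between nothing  x y = false

  interactingLeft : Cell n → Cell n → Bool
  interactingLeft (r₁ , c₁) (r₂ , c₂) =
    isLeftLeaf r₁ c₁ ∧ isLeftLeaf r₂ c₂ ∧
    (between (parentRow r₁ c₁) r₂ r₁ ∨ between (parentRow r₂ c₂) r₁ r₂)

  interactingRight : Cell n → Cell n → Bool
  interactingRight (r₁ , c₁) (r₂ , c₂) =
    isRightLeaf r₁ c₁ ∧ isRightLeaf r₂ c₂ ∧
    (between (parentCol r₁ c₁) c₂ c₁ ∨ between (parentCol r₂ c₂) c₁ c₂)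

  -- ordered pair of interacting left leaves with (r(l₁), r(l₂))
  -- lexicographically maximal (columns only break ties, which cannot
  -- occur in a CNAT since each row contains exactly one leaf)
  maxInteractingLeft : Maybe (Cell n × Cell n)
  maxInteractingLeft =
    findLast λ r₁ → findLast λ r₂ → findLast λ c₁ → findLast λ c₂ →
      if interactingLeft (r₁ , c₁) (r₂ , c₂)
      then just ((r₁ , c₁) , (r₂ , c₂)) else nothing

  maxInteractingRight : Maybe (Cell n × Cell n)
  maxInteractingRight =
    findLast λ c₁ → findLast λ c₂ → findLast λ r₁ → findLast λ r₂ →
      if interactingRight (r₁ , c₁) (r₂ , c₂)
      then just ((r₁ , c₁) , (r₂ , c₂)) else nothing

  -- the switch S(T, l₁, l₂): remove the dots l₁ = (r₁,c₁), l₂ = (r₂,c₂)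
  -- and put dots at (r₂,c₁) and (r₁,c₂).  (For left leaves this exchanges
  -- their rows, for right leaves their columns: it is the same filling.)
  switch : Cell n → Cell n → Grid n
  switch (r₁ , c₁) (r₂ , c₂) r c =
    if ((r ≡ᶠ r₂) ∧ (c ≡ᶠ c₁)) ∨ ((r ≡ᶠ r₁) ∧ (c ≡ᶠ c₂)) then true
    else if ((r ≡ᶠ r₁) ∧ (c ≡ᶠ c₁)) ∨ ((r ≡ᶠ r₂) ∧ (c ≡ᶠ c₂)) then false
    else T r c

  -- the associated permutation: π(T)(i) = row of the leaf in column i
  -- (the default value i is never used when T is a CNAT)
  perm : Fin n → Fin n
  perm i = fromMaybe i (findLast (λ r → if isLeaf r i then just r else nothing))

Φ : ∀ {n} → Grid n → Grid n
Φ T with allShort T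
... | true  = T
... | false with maxInteractingLeft T
...   | just (l₁ , l₂) = switch T l₁ l₂
...   | nothing with maxInteractingRight T
...     | just (l₁ , l₂) = switch T l₁ l₂
...     | nothing = T

Dot : ∀ {n} → Grid n → Fin n → Fin n → Set
Dot T r c = T r c ≡ true

record IsNAT {n : ℕ} (T : Grid n) : Set where
  field
    root     : ∀ r c → toℕ r ≡ 0 → toℕ c ≡ 0 → Dot T r c
    parent   : ∀ r c → Dot T r c → ((toℕ r ≡ 0 × toℕ c ≡ 0) → ⊥) →
               (dotAbove T r c xor dotLeft T r c) ≡ true
    rowDot   : ∀ r → ∃[ c ] Dot T r c
    colDot   : ∀ c → ∃[ r ] Dot T r c

record IsCNAT {n : ℕ} (T : Grid n) : Set where
  field
    nat      : IsNAT T
    complete : ∀ r c → Dot T r c →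
               (dotBelow T r c ∧ dotRight T r c) ∨
               (not (dotBelow T r c) ∧ not (dotRight T r c)) ≡ true

InA : ∀ {n} → Grid n → Set
InA T = allShort T ≡ true

inversions : ∀ {n} → (Fin n → Fin n) → ℕ
inversions f = sumF λ i → sumF λ j →
  if (i <ᶠ j) ∧ (f j <ᶠ f i) then 1 else 0

sgn : ∀ {n} → (Fin n → Fin n) → ℤ
sgn f = if inversions f % 2 ≡ᵇ 0 then 1ℤ else -1ℤ

_≋_ : ∀ {n} → Grid n → Grid n → Set
T ≋ U = ∀ r c → T r c ≡ U r c

-- If l₂ lies between the left leaf l₁ and its parent, exchanging the rows
-- of l₁ and l₂ yields a CNAT in which the two new leaves interact again and form the new maximal pair,
-- the lower of which is long; switching them back restores the tree.  The leaves of the new tree are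
-- those of the old one with two columns exchanged, so the sign of the permutation flips.  Right
-- leaves are reduced to left leaves by transposing the grid.  Finally, a long left leaf forces an
-- interacting pair: otherwise the row just below its parent carries a right leaf, and sending each
-- left-leaf row to the row of its parent injects the left-leaf rows into the remaining right-leaf
-- rows, while the same map for the transposed grid injects right leaves into left leaves.

module Submission where

open import Defs
open import Data.Bool.Base using (Bool; true; false; _∧_; _∨_; not; if_then_else_; _xor_; T)
open import Data.Bool.Properties using (∧-comm; ∨-comm; xor-comm; not-involutive; ∧-identityʳ; ∧-zeroʳ; ¬-not; not-¬; T-≡; not-distribˡ-xor; xor-same)
open import Data.Nat.Base as ℕ using (ℕ; zero; suc; _+_; _≤_; z≤n; s≤s; _≡ᵇ_; _%_)
import Data.Nat.Properties as ℕ
open import Data.Nat.Solver using (module +-*-Solver)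
open import Data.Fin.Base using (Fin; toℕ; fromℕ<; _<_) renaming (zero to fzero; suc to fsuc)
open import Data.Fin.Properties using (toℕ-injective; suc-injective; toℕ-fromℕ<; toℕ<n; <-cmp; <-irrefl; <-asym; <-trans; <⇒≢; _≟_)
open import Data.Maybe.Base using (Maybe; just; nothing; _<∣>_; fromMaybe)
import Data.Maybe.Base as Maybe
open import Data.Maybe.Properties using (just-injective; map-<∣>)
open import Data.Product.Base using (_×_; _,_; ∃-syntax; proj₁; proj₂)
open import Data.Sum.Base using (_⊎_; inj₁; inj₂)
open import Data.Empty using (⊥; ⊥-elim)
open import Function.Base using (_∘_)
open import Function.Bundles using (Equivalence)
open import Data.Integer.Base using (-_; 1ℤ; -1ℤ)
open import Data.Fin.Permutation.Components using (transpose)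
open import Relation.Binary.Definitions using (tri<; tri≈; tri>)
open import Relation.Binary.PropositionalEquality
open import Relation.Nullary.Negation using (¬_)
open import Relation.Nullary.Decidable using (yes; no; dec-true; dec-false)

private variable
  n : ℕ
  A B : Set

∧-trueˡ : ∀ {a b} → a ∧ b ≡ true → a ≡ true
∧-trueˡ {true} _ = refl

∧-trueʳ : ∀ {a b} → a ∧ b ≡ true → b ≡ true
∧-trueʳ {true} e = e

∧-true : ∀ {a b} → a ≡ true → b ≡ true → a ∧ b ≡ true
∧-true refl refl = refl

∨-true⁻ : ∀ {a b} → a ∨ b ≡ true → a ≡ true ⊎ b ≡ true
∨-true⁻ {true} _ = inj₁ refl
∨-true⁻ {false} e = inj₂ e

∨-trueˡ : ∀ {a} b → a ≡ true → a ∨ b ≡ true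
∨-trueˡ b refl = refl

∨-trueʳ : ∀ a {b} → b ≡ true → a ∨ b ≡ true
∨-trueʳ true _ = refl
∨-trueʳ false e = e

not-true⁻ : ∀ {a} → not a ≡ true → a ≡ false
not-true⁻ {false} _ = refl

true-or-false : ∀ b → b ≡ true ⊎ b ≡ false
true-or-false true = inj₁ refl
true-or-false false = inj₂ refl

if-true : ∀ {b} {x y : A} → b ≡ true → (if b then x else y) ≡ x
if-true refl = refl

if-false : ∀ {b} {x y : A} → b ≡ false → (if b then x else y) ≡ y
if-false refl = refl

just≢nothing : ∀ {x : A} → just x ≢ nothing
just≢nothing ()

module _ {i j : Fin n} where

  <ᶠ-true⁻ : (i <ᶠ j) ≡ true → i < j
  <ᶠ-true⁻ e = ℕ.<ᵇ⇒< (toℕ i) (toℕ j) (Equivalence.from T-≡ e)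

  <ᶠ-true : i < j → (i <ᶠ j) ≡ true
  <ᶠ-true p = Equivalence.to T-≡ (ℕ.<⇒<ᵇ p)

  <ᶠ-false : ¬ i < j → (i <ᶠ j) ≡ false
  <ᶠ-false h = ¬-not (λ e → h (<ᶠ-true⁻ e))

  ≡ᶠ-true⁻ : (i ≡ᶠ j) ≡ true → i ≡ j
  ≡ᶠ-true⁻ e = toℕ-injective (ℕ.≡ᵇ⇒≡ (toℕ i) (toℕ j) (Equivalence.from T-≡ e))

  ≡ᶠ-true : i ≡ j → (i ≡ᶠ j) ≡ true
  ≡ᶠ-true refl = Equivalence.to T-≡ (ℕ.≡⇒≡ᵇ (toℕ i) (toℕ i) refl)

  ≡ᶠ-false : i ≢ j → (i ≡ᶠ j) ≡ false
  ≡ᶠ-false h = ¬-not (λ e → h (≡ᶠ-true⁻ e))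

≡ᶠ-refl : (i : Fin n) → (i ≡ᶠ i) ≡ true
≡ᶠ-refl i = ≡ᶠ-true {i = i} {j = i} refl

<ᶠ-irrefl : (i : Fin n) → (i <ᶠ i) ≡ false
<ᶠ-irrefl i = <ᶠ-false {i = i} {j = i} (<-irrefl refl)

<ᶠ-flip : {i j : Fin n} → i ≢ j → (j <ᶠ i) ≡ not (i <ᶠ j)
<ᶠ-flip {i = i} {j} i≢j with <-cmp i j
... | tri< i<j _ _ rewrite <ᶠ-true i<j = <ᶠ-false (<-asym i<j)
... | tri≈ _ i≡j _ = ⊥-elim (i≢j i≡j)
... | tri> _ _ j<i rewrite <ᶠ-true j<i | <ᶠ-false (<-asym j<i) = refl

≡-or-≢ : (i j : Fin n) → i ≡ j ⊎ i ≢ j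
≡-or-≢ i j with i ≟ j
... | yes i≡j = inj₁ i≡j
... | no i≢j = inj₂ i≢j

if-just⁻ : ∀ b {x y : A} → (if b then just x else nothing) ≡ just y → b ≡ true × x ≡ y
if-just⁻ true refl = refl , refl

if-nothing⁻ : ∀ b {x : A} → (if b then just x else nothing) ≡ nothing → b ≡ false
if-nothing⁻ false _ = refl

anyF-true⁺ : (f : Fin n → Bool) (i : Fin n) → f i ≡ true → anyF f ≡ true
anyF-true⁺ f fzero e rewrite e = refl
anyF-true⁺ f (fsuc i) e = ∨-trueʳ (f fzero) (anyF-true⁺ (f ∘ fsuc) i e)

anyF-true⁻ : (f : Fin n → Bool) → anyF f ≡ true → ∃[ i ] f i ≡ true
anyF-true⁻ {suc n} f e with ∨-true⁻ {f fzero} e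
... | inj₁ e₀ = fzero , e₀
... | inj₂ e₁ with anyF-true⁻ (f ∘ fsuc) e₁
...   | i , eᵢ = fsuc i , eᵢ

anyF-cong : {f g : Fin n → Bool} → (∀ i → f i ≡ g i) → anyF f ≡ anyF g
anyF-cong {zero} h = refl
anyF-cong {suc n} h = cong₂ _∨_ (h fzero) (anyF-cong (h ∘ fsuc))

allF-true⁻ : (f : Fin n → Bool) → allF f ≡ true → ∀ i → f i ≡ true
allF-true⁻ f e fzero = ∧-trueˡ e
allF-true⁻ f e (fsuc i) = allF-true⁻ (f ∘ fsuc) (∧-trueʳ {f fzero} e) i

allF-false⁺ : (f : Fin n → Bool) (i : Fin n) → f i ≡ false → allF f ≡ false
allF-false⁺ f i e = ¬-not λ all → not-¬ (allF-true⁻ f all i) e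

allF-false⁻ : (f : Fin n → Bool) → allF f ≡ false → ∃[ i ] f i ≡ false
allF-false⁻ {suc n} f e with f fzero in e₀
... | false = fzero , e₀
... | true with allF-false⁻ (f ∘ fsuc) e
...   | i , eᵢ = fsuc i , eᵢ

findLast-cong : {f g : Fin n → Maybe A} → (∀ i → f i ≡ g i) → findLast f ≡ findLast g
findLast-cong {zero} h = refl
findLast-cong {suc n} h = cong₂ _<∣>_ (findLast-cong (h ∘ fsuc)) (h fzero)

findLast-map : (g : A → B) (f : Fin n → Maybe A) →
               findLast (Maybe.map g ∘ f) ≡ Maybe.map g (findLast f)
findLast-map {n = zero} g f = refl
findLast-map {n = suc n} g f rewrite findLast-map g (f ∘ fsuc) =
  sym (map-<∣> g (findLast (f ∘ fsuc)) (f fzero))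

findLast-nothing⁺ : (f : Fin n → Maybe A) → (∀ i → f i ≡ nothing) → findLast f ≡ nothing
findLast-nothing⁺ {zero} f h = refl
findLast-nothing⁺ {suc n} f h rewrite findLast-nothing⁺ (f ∘ fsuc) (h ∘ fsuc) = h fzero

findLast-nothing⁻ : (f : Fin n → Maybe A) → findLast f ≡ nothing → ∀ i → f i ≡ nothing
findLast-nothing⁻ {suc n} f e i with findLast (f ∘ fsuc) in e₁ | i
... | nothing | fzero = e
... | nothing | fsuc i = findLast-nothing⁻ (f ∘ fsuc) e₁ i

LastJust : (Fin n → Maybe A) → Fin n → A → Set
LastJust f i a = f i ≡ just a × (∀ j → i < j → f j ≡ nothing)

findLast-just⁺ : (f : Fin n → Maybe A) {a : A} (i : Fin n) → LastJust f i a → findLast f ≡ just a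
findLast-just⁺ {suc n} f fzero (e , h) rewrite findLast-nothing⁺ (f ∘ fsuc) (λ j → h (fsuc j) (s≤s z≤n)) = e
findLast-just⁺ {suc n} f (fsuc i) (e , h)
  rewrite findLast-just⁺ (f ∘ fsuc) i (e , λ j i<j → h (fsuc j) (s≤s i<j)) = refl

findLast-just⁻ : (f : Fin n → Maybe A) {a : A} → findLast f ≡ just a → ∃[ i ] LastJust f i a
findLast-just⁻ {suc n} f e with findLast (f ∘ fsuc) in e₁
... | just _ with e
...   | refl with findLast-just⁻ (f ∘ fsuc) e₁
...     | i , eᵢ , h = fsuc i , eᵢ , λ { fzero () ; (fsuc j) (s≤s i<j) → h j i<j }
findLast-just⁻ {suc n} f e | nothing =
  fzero , e , λ { fzero () ; (fsuc j) _ → findLast-nothing⁻ (f ∘ fsuc) e₁ j }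

sumF-cong : {f g : Fin n → ℕ} → (∀ i → f i ≡ g i) → sumF f ≡ sumF g
sumF-cong {zero} h = refl
sumF-cong {suc n} h = cong₂ _+_ (h fzero) (sumF-cong (h ∘ fsuc))

sumF-zero : (f : Fin n → ℕ) → (∀ i → f i ≡ 0) → sumF f ≡ 0
sumF-zero {zero} f h = refl
sumF-zero {suc n} f h rewrite h fzero = sumF-zero (f ∘ fsuc) (h ∘ fsuc)

sumF-+ : (f g : Fin n → ℕ) → sumF (λ i → f i + g i) ≡ sumF f + sumF g
sumF-+ {zero} f g = refl
sumF-+ {suc n} f g rewrite sumF-+ (f ∘ fsuc) (g ∘ fsuc) =
  interchange (f fzero) (g fzero) (sumF (f ∘ fsuc)) (sumF (g ∘ fsuc))
  where
  open +-*-Solver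
  interchange : ∀ a b c d → a + b + (c + d) ≡ a + c + (b + d)
  interchange = solve 4 (λ a b c d → a :+ b :+ (c :+ d) := a :+ c :+ (b :+ d)) refl

sumF-swap : ∀ {m} (F : Fin n → Fin m → ℕ) →
            sumF (λ i → sumF (F i)) ≡ sumF (λ j → sumF (λ i → F i j))
sumF-swap {zero} {m} F = sym (sumF-zero {m} (λ _ → 0) (λ _ → refl))
sumF-swap {suc n} F =
  trans (cong (sumF (F fzero) +_) (sumF-swap (F ∘ fsuc)))
        (sym (sumF-+ (F fzero) (λ j → sumF (λ i → F (fsuc i) j))))

sumF-mono : (f g : Fin n → ℕ) → (∀ i → f i ≤ g i) → sumF f ≤ sumF g
sumF-mono {zero} f g h = z≤n
sumF-mono {suc n} f g h = ℕ.+-mono-≤ (h fzero) (sumF-mono (f ∘ fsuc) (g ∘ fsuc) (h ∘ fsuc))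

sumF-delta : (f : Fin n → ℕ) (x : Fin n) → sumF (λ i → if i ≡ᶠ x then f i else 0) ≡ f x
sumF-delta {suc n} f fzero =
  trans (cong (f fzero +_) (sumF-zero (λ i → if fsuc i ≡ᶠ fzero then f (fsuc i) else 0) (λ _ → refl)))
        (ℕ.+-identityʳ (f fzero))
sumF-delta {suc n} f (fsuc x) = sumF-delta (f ∘ fsuc) x

ind : Bool → ℕ
ind b = if b then 1 else 0

count : (Fin n → Bool) → ℕ
count P = sumF (ind ∘ P)

AtMostOne : (Fin n → Bool) → Set
AtMostOne P = ∀ i j → P i ≡ true → P j ≡ true → i ≡ j

ind-anyF : (P : Fin n → Bool) → AtMostOne P → ind (anyF P) ≡ count P
ind-anyF {zero} P h = refl
ind-anyF {suc n} P h with P fzero in e₀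
... | true = sym (cong suc (sumF-zero _ rest-false))
  where
  rest-false : ∀ i → ind (P (fsuc i)) ≡ 0
  rest-false i with P (fsuc i) in eᵢ
  ... | false = refl
  ... | true with h fzero (fsuc i) e₀ eᵢ
  ...   | ()
... | false = ind-anyF (P ∘ fsuc) λ i j pi pj → suc-injective (h (fsuc i) (fsuc j) pi pj)

count-rows≡count-cols : (R : Fin n → Fin n → Bool) →
  (∀ r → AtMostOne (R r)) → (∀ c → AtMostOne (λ r → R r c)) →
  count (λ r → anyF (R r)) ≡ count (λ c → anyF (λ r → R r c))
count-rows≡count-cols R rows cols = begin
  sumF (λ r → ind (anyF (R r)))         ≡⟨ sumF-cong (λ r → ind-anyF (R r) (rows r)) ⟩
  sumF (λ r → sumF (λ c → ind (R r c))) ≡⟨ sumF-swap (λ r c → ind (R r c)) ⟩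
  sumF (λ c → sumF (λ r → ind (R r c))) ≡⟨ sumF-cong (λ c → ind-anyF (λ r → R r c) (cols c)) ⟨
  sumF (λ c → ind (anyF (λ r → R r c))) ∎
  where open ≡-Reasoning

count-injection : (P Q : Fin n → Bool) (f : Fin n → Fin n) →
  (∀ i → P i ≡ true → Q (f i) ≡ true) →
  (∀ i j → P i ≡ true → P j ≡ true → f i ≡ f j → i ≡ j) →
  count P ≤ count Q
count-injection {n} P Q f maps injective = begin
  count P                                  ≡⟨ sumF-cong graph-row ⟩
  sumF (λ i → sumF (λ j → ind (G i j)))   ≡⟨ sumF-swap (λ i j → ind (G i j)) ⟩
  sumF (λ j → sumF (λ i → ind (G i j)))   ≤⟨ sumF-mono _ _ graph-col ⟩
  count Q                                  ∎
  where
  open ℕ.≤-Reasoning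
  G : Fin n → Fin n → Bool
  G i j = P i ∧ (j ≡ᶠ f i)
  graph-row : ∀ i → ind (P i) ≡ sumF (λ j → ind (G i j))
  graph-row i = cases (P i) refl
    where
    cases : ∀ b → P i ≡ b → ind b ≡ sumF (λ j → ind (G i j))
    cases true  e = sym (trans (sumF-cong λ j → cong (λ b → ind (b ∧ (j ≡ᶠ f i))) e) (sumF-delta (λ _ → 1) (f i)))
    cases false e = sym (sumF-zero _ λ j → cong (λ b → ind (b ∧ (j ≡ᶠ f i))) e)
  G-col-atMostOne : ∀ j → AtMostOne (λ i → G i j)
  G-col-atMostOne j i k gi gk = injective i k (∧-trueˡ gi) (∧-trueˡ gk)
    (trans (sym (≡ᶠ-true⁻ {i = j} (∧-trueʳ {P i} gi))) (≡ᶠ-true⁻ {i = j} (∧-trueʳ {P k} gk)))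
  graph-col : ∀ j → sumF (λ i → ind (G i j)) ≤ ind (Q j)
  graph-col j rewrite sym (ind-anyF (λ i → G i j) (G-col-atMostOne j)) with anyF (λ i → G i j) in e
  ... | false = z≤n
  ... | true with anyF-true⁻ _ e
  ...   | i , gij rewrite ≡ᶠ-true⁻ {i = j} (∧-trueʳ {P i} gij) | maps i (∧-trueˡ gij) = s≤s z≤n

count-remove : (Q : Fin n → Bool) (s : Fin n) → Q s ≡ true →
               count Q ≡ suc (count (λ i → Q i ∧ not (i ≡ᶠ s)))
count-remove {n} Q s Qs = begin
  count Q                                 ≡⟨ sumF-cong split ⟩
  sumF (λ i → at-s i + ind (Q′ i))        ≡⟨ sumF-+ at-s (ind ∘ Q′) ⟩
  sumF at-s + count Q′                    ≡⟨ cong (_+ count Q′) (sumF-delta (ind ∘ Q) s) ⟩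
  ind (Q s) + count Q′                    ≡⟨ cong (λ b → ind b + count Q′) Qs ⟩
  suc (count Q′)                          ∎
  where
  open ≡-Reasoning
  Q′ : Fin n → Bool
  Q′ i = Q i ∧ not (i ≡ᶠ s)
  at-s : Fin n → ℕ
  at-s i = if i ≡ᶠ s then ind (Q i) else 0
  split : ∀ i → ind (Q i) ≡ at-s i + ind (Q′ i)
  split i with i ≡ᶠ s | Q i
  ... | true  | true  = refl
  ... | true  | false = refl
  ... | false | true  = refl
  ... | false | false = refl

odd : ℕ → Bool
odd zero = false
odd (suc n) = not (odd n)

odd-+ : ∀ a b → odd (a + b) ≡ odd a xor odd b
odd-+ zero b = refl
odd-+ (suc a) b = trans (cong not (odd-+ a b)) (not-distribˡ-xor (odd a) (odd b))

odd-ind : ∀ b → odd (ind b) ≡ b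
odd-ind true = refl
odd-ind false = refl

odd-double : ∀ a → odd (a + a) ≡ false
odd-double a = trans (odd-+ a a) (xor-same (odd a))

odd-sumF : (f : Fin n → ℕ) → (∀ i → odd (f i) ≡ false) → odd (sumF f) ≡ false
odd-sumF {zero} f h = refl
odd-sumF {suc n} f h rewrite odd-+ (f fzero) (sumF (f ∘ fsuc)) | h fzero = odd-sumF (f ∘ fsuc) (h ∘ fsuc)

%2≡ᵇ0≡not-odd : ∀ m → (m % 2 ≡ᵇ 0) ≡ not (odd m)
%2≡ᵇ0≡not-odd zero = refl
%2≡ᵇ0≡not-odd (suc zero) = refl
%2≡ᵇ0≡not-odd (suc (suc m)) = trans (%2≡ᵇ0≡not-odd m) (cong not (sym (not-involutive (odd m))))

transpose-left : (i j : Fin n) → transpose i j i ≡ j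
transpose-left i j rewrite dec-true (i ≟ i) refl = refl

transpose-right : (i j : Fin n) → transpose i j j ≡ i
transpose-right i j with j ≟ i
... | yes refl = refl
... | no j≢i rewrite dec-true (j ≟ j) refl = refl

transpose-other : {i j k : Fin n} → k ≢ i → k ≢ j → transpose i j k ≡ k
transpose-other {i = i} {j} {k} k≢i k≢j rewrite dec-false (k ≟ i) k≢i | dec-false (k ≟ j) k≢j = refl

transpose-comm : (i j k : Fin n) → transpose i j k ≡ transpose j i k
transpose-comm i j k with ≡-or-≢ k i | ≡-or-≢ k j
... | inj₁ refl | inj₁ refl = refl
... | inj₁ refl | inj₂ k≢j = trans (transpose-left k j) (sym (transpose-right j k))
... | inj₂ k≢i | inj₁ refl = trans (transpose-right i k) (sym (transpose-left k i))
... | inj₂ k≢i | inj₂ k≢j = trans (transpose-other k≢i k≢j) (sym (transpose-other k≢j k≢i))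

sgn-opposite : (g h : Fin n → Fin n) → odd (inversions g + inversions h) ≡ true → sgn g ≡ - sgn h
sgn-opposite g h odd-sum rewrite %2≡ᵇ0≡not-odd (inversions g) | %2≡ᵇ0≡not-odd (inversions h)
                               | odd-+ (inversions g) (inversions h)
  with odd (inversions g) | odd (inversions h) | odd-sum
... | true  | false | _ = refl
... | false | true  | _ = refl

sgn-cong : {f g : Fin n → Fin n} → (∀ i → f i ≡ g i) → sgn f ≡ sgn g
sgn-cong h = cong (λ m → if m % 2 ≡ᵇ 0 then 1ℤ else -1ℤ)
  (sumF-cong λ i → sumF-cong λ j → cong₂ (λ a b → if (i <ᶠ j) ∧ (b <ᶠ a) then 1 else 0) (h i) (h j))

module TwoPoints {x y : Fin n} (x≢y : x ≢ y) where

  outside : (Fin n → ℕ) → Fin n → ℕ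
  outside f i = if (i ≡ᶠ x) ∨ (i ≡ᶠ y) then 0 else f i

  outside-+ : (f g : Fin n → ℕ) → ∀ i → outside (λ k → f k + g k) i ≡ outside f i + outside g i
  outside-+ f g i with (i ≡ᶠ x) ∨ (i ≡ᶠ y)
  ... | true = refl
  ... | false = refl

  outside-cong : {f g : Fin n → ℕ} → (∀ i → f i ≡ g i) → ∀ i → outside f i ≡ outside g i
  outside-cong h i with (i ≡ᶠ x) ∨ (i ≡ᶠ y)
  ... | true = refl
  ... | false = h i

  sumF-outside-+ : (f g : Fin n → ℕ) → sumF (outside (λ k → f k + g k)) ≡ sumF (outside f) + sumF (outside g)
  sumF-outside-+ f g = trans (sumF-cong (outside-+ f g)) (sumF-+ (outside f) (outside g))

  sumF-split : (f : Fin n → ℕ) → sumF f ≡ f x + (f y + sumF (outside f))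
  sumF-split f = begin
    sumF f                                                            ≡⟨ sumF-cong pointwise ⟩
    sumF (λ i → at x i + (at y i + outside f i))                      ≡⟨ sumF-+ (at x) _ ⟩
    sumF (at x) + sumF (λ i → at y i + outside f i)                   ≡⟨ cong (sumF (at x) +_) (sumF-+ (at y) _) ⟩
    sumF (at x) + (sumF (at y) + sumF (outside f))                    ≡⟨ cong₂ (λ a b → a + (b + sumF (outside f)))
                                                                           (sumF-delta f x) (sumF-delta f y) ⟩
    f x + (f y + sumF (outside f))                                    ∎
    where
    open ≡-Reasoning
    at : Fin n → Fin n → ℕ
    at z i = if i ≡ᶠ z then f i else 0
    pointwise : ∀ i → f i ≡ at x i + (at y i + outside f i)
    pointwise i with i ≡ᶠ x in ex | i ≡ᶠ y in ey
    ... | true  | true  = ⊥-elim (x≢y (trans (sym (≡ᶠ-true⁻ {i = i} ex)) (≡ᶠ-true⁻ {i = i} ey)))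
    ... | true  | false = sym (ℕ.+-identityʳ (f i))
    ... | false | true  = sym (ℕ.+-identityʳ (f i))
    ... | false | false = refl

  sumF²-split : (g : Fin n → Fin n → ℕ) → sumF (λ i → sumF (g i)) ≡
    (g x y + g y x) + (g x x + g y y)
      + sumF (outside (λ k → g x k + g y k + (g k x + g k y)))
      + sumF (outside (λ i → sumF (outside (g i))))
  sumF²-split g = begin
    sumF row
      ≡⟨ sumF-split row ⟩
    row x + (row y + sumF (outside row))
      ≡⟨ cong₂ (λ a b → a + (b + sumF (outside row))) (sumF-split (g x)) (sumF-split (g y)) ⟩
    (g x x + (g x y + inner x)) + ((g y x + (g y y + inner y)) + sumF (outside row))
      ≡⟨ cong (λ z → (g x x + (g x y + inner x)) + ((g y x + (g y y + inner y)) + z)) outside-rows ⟩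
    (g x x + (g x y + inner x)) + ((g y x + (g y y + inner y)) + (sumF colx + (sumF coly + sumF (outside inner))))
      ≡⟨ rearrange (g x x) (g x y) (g y x) (g y y) (inner x) (inner y) (sumF colx) (sumF coly) (sumF (outside inner)) ⟩
    (g x y + g y x) + (g x x + g y y) + (inner x + inner y + (sumF colx + sumF coly)) + sumF (outside inner)
      ≡⟨ cong (λ z → (g x y + g y x) + (g x x + g y y) + z + sumF (outside inner)) cross ⟨
    (g x y + g y x) + (g x x + g y y)
      + sumF (outside (λ k → g x k + g y k + (g k x + g k y))) + sumF (outside inner) ∎
    where
    open ≡-Reasoning
    row inner : Fin n → ℕ
    row i = sumF (g i)
    inner i = sumF (outside (g i))
    colx coly : Fin n → ℕ
    colx i = outside (λ k → g k x) i
    coly i = outside (λ k → g k y) i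
    outside-rows : sumF (outside row) ≡ sumF colx + (sumF coly + sumF (outside inner))
    outside-rows = begin
      sumF (outside row)                                              ≡⟨ sumF-cong (outside-cong (λ i → sumF-split (g i))) ⟩
      sumF (outside (λ i → g i x + (g i y + inner i)))                ≡⟨ sumF-outside-+ (λ i → g i x) _ ⟩
      sumF colx + sumF (outside (λ i → g i y + inner i))              ≡⟨ cong (sumF colx +_) (sumF-outside-+ (λ i → g i y) inner) ⟩
      sumF colx + (sumF coly + sumF (outside inner))                  ∎
    cross : sumF (outside (λ k → g x k + g y k + (g k x + g k y))) ≡ inner x + inner y + (sumF colx + sumF coly)
    cross = begin
      sumF (outside (λ k → g x k + g y k + (g k x + g k y)))
        ≡⟨ sumF-outside-+ (λ k → g x k + g y k) (λ k → g k x + g k y) ⟩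
      sumF (outside (λ k → g x k + g y k)) + sumF (outside (λ k → g k x + g k y))
        ≡⟨ cong₂ _+_ (sumF-outside-+ (g x) (g y)) (sumF-outside-+ (λ k → g k x) (λ k → g k y)) ⟩
      inner x + inner y + (sumF colx + sumF coly) ∎
    open +-*-Solver using (solve; _:+_; _:=_)
    rearrange : ∀ a b c d e f p q r → (a + (b + e)) + ((c + (d + f)) + (p + (q + r))) ≡
                (b + c) + (a + d) + (e + f + (p + q)) + r
    rearrange = solve 9 (λ a b c d e f p q r → (a :+ (b :+ e)) :+ ((c :+ (d :+ f)) :+ (p :+ (q :+ r)))
                                                := (b :+ c) :+ (a :+ d) :+ (e :+ f :+ (p :+ q)) :+ r) refl

inversion : (Fin n → Fin n) → Fin n → Fin n → ℕ
inversion g i j = ind ((i <ᶠ j) ∧ (g j <ᶠ g i))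

-- Pairs {i , j} avoiding x and y are inversions of f ∘ transpose x y iff they are inversions of f, and the
-- pairs meeting {x , y} in one point cancel modulo 2; only the pair {x , y} changes status.
module TranspositionParity (f : Fin n → Fin n) (f-injective : ∀ i j → f i ≡ f j → i ≡ j)
                           {x y : Fin n} (x<y : x < y) where

  open TwoPoints (<⇒≢ x<y)

  private
    x≢y : x ≢ y
    x≢y = <⇒≢ x<y

    f-≢ : ∀ {i j} → i ≢ j → f i ≢ f j
    f-≢ i≢j e = i≢j (f-injective _ _ e)

    h : Fin n → Fin n
    h = f ∘ transpose x y

    w : Fin n → Fin n → ℕ
    w i j = inversion h i j + inversion f i j

    pair diagonal : ℕ
    pair = w x y + w y x
    diagonal = w x x + w y y

    mixed far : Fin n → ℕ
    mixed k = w x k + w y k + (w k x + w k y)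
    far i = sumF (outside (w i))

    h-away : ∀ {k} → k ≢ x → k ≢ y → h k ≡ f k
    h-away k≢x k≢y = cong f (transpose-other k≢x k≢y)

    odd-w : ∀ i j → odd (w i j) ≡ ((i <ᶠ j) ∧ (h j <ᶠ h i)) xor ((i <ᶠ j) ∧ (f j <ᶠ f i))
    odd-w i j = trans (odd-+ (inversion h i j) (inversion f i j))
                      (cong₂ _xor_ (odd-ind ((i <ᶠ j) ∧ (h j <ᶠ h i))) (odd-ind ((i <ᶠ j) ∧ (f j <ᶠ f i))))

    odd-pair : odd pair ≡ true
    odd-pair rewrite odd-+ (w x y) (w y x) | odd-w x y | odd-w y x
                   | <ᶠ-true x<y | <ᶠ-false {i = y} {j = x} (<-asym x<y)
                   | transpose-left x y | transpose-right x y
                   | <ᶠ-flip {i = f x} {j = f y} (f-≢ x≢y)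
             with f x <ᶠ f y
    ... | true = refl
    ... | false = refl

    odd-diagonal : odd diagonal ≡ false
    odd-diagonal rewrite odd-+ (w x x) (w y y) | odd-w x x | odd-w y y | <ᶠ-irrefl x | <ᶠ-irrefl y = refl

    -- a = [x < k], b = [y < k], p = [f k < f x], q = [f k < f y]: for k ∉ {x, y} the pairs
    -- {x, k} and {y, k} are inversions of h exactly when {y, k} and {x, k} are inversions of f
    cancel : ∀ a b p q → (((a ∧ q) xor (a ∧ p)) xor ((b ∧ p) xor (b ∧ q))) xor
                         (((not a ∧ not q) xor (not a ∧ not p)) xor ((not b ∧ not p) xor (not b ∧ not q))) ≡ false
    cancel true  true  true  true  = refl
    cancel true  true  true  false = refl
    cancel true  true  false true  = refl
    cancel true  true  false false = refl
    cancel true  false true  true  = refl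
    cancel true  false true  false = refl
    cancel true  false false true  = refl
    cancel true  false false false = refl
    cancel false true  true  true  = refl
    cancel false true  true  false = refl
    cancel false true  false true  = refl
    cancel false true  false false = refl
    cancel false false true  true  = refl
    cancel false false true  false = refl
    cancel false false false true  = refl
    cancel false false false false = refl

    odd-mixed : ∀ k → odd (outside mixed k) ≡ false
    odd-mixed k with ≡-or-≢ k x | ≡-or-≢ k y
    ... | inj₁ refl | _ rewrite ≡ᶠ-refl k = refl
    ... | inj₂ k≢x | inj₁ refl rewrite ≡ᶠ-refl k | ≡ᶠ-false k≢x = refl
    ... | inj₂ k≢x | inj₂ k≢y
      rewrite ≡ᶠ-false k≢x | ≡ᶠ-false k≢y
            | odd-+ (w x k + w y k) (w k x + w k y) | odd-+ (w x k) (w y k) | odd-+ (w k x) (w k y)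
            | odd-w x k | odd-w y k | odd-w k x | odd-w k y
            | h-away k≢x k≢y | transpose-left x y | transpose-right x y
            | <ᶠ-flip {i = x} {j = k} (k≢x ∘ sym) | <ᶠ-flip {i = y} {j = k} (k≢y ∘ sym)
            | <ᶠ-flip {i = f k} {j = f y} (f-≢ k≢y) | <ᶠ-flip {i = f k} {j = f x} (f-≢ k≢x)
      = cancel (x <ᶠ k) (y <ᶠ k) (f k <ᶠ f x) (f k <ᶠ f y)

    odd-far : ∀ i → odd (outside far i) ≡ false
    odd-far i with ≡-or-≢ i x | ≡-or-≢ i y
    ... | inj₁ refl | _ rewrite ≡ᶠ-refl i = refl
    ... | inj₂ i≢x | inj₁ refl rewrite ≡ᶠ-refl i | ≡ᶠ-false i≢x = refl
    ... | inj₂ i≢x | inj₂ i≢y rewrite ≡ᶠ-false i≢x | ≡ᶠ-false i≢y = odd-sumF (outside (w i)) odd-cell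
      where
      odd-cell : ∀ j → odd (outside (w i) j) ≡ false
      odd-cell j with ≡-or-≢ j x | ≡-or-≢ j y
      ... | inj₁ refl | _ rewrite ≡ᶠ-refl j = refl
      ... | inj₂ j≢x | inj₁ refl rewrite ≡ᶠ-refl j | ≡ᶠ-false j≢x = refl
      ... | inj₂ j≢x | inj₂ j≢y rewrite ≡ᶠ-false j≢x | ≡ᶠ-false j≢y
                                      | h-away i≢x i≢y | h-away j≢x j≢y = odd-double (inversion f i j)

  odd-inversions-transpose : odd (inversions (f ∘ transpose x y) + inversions f) ≡ true
  odd-inversions-transpose = begin
    odd (inversions h + inversions f)
      ≡⟨ cong odd (trans (sym (sumF-+ (λ i → sumF (inversion h i)) (λ i → sumF (inversion f i))))
                         (sumF-cong λ i → sym (sumF-+ (inversion h i) (inversion f i)))) ⟩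
    odd (sumF (λ i → sumF (w i)))
      ≡⟨ cong odd (sumF²-split w) ⟩
    odd (pair + diagonal + sumF (outside mixed) + sumF (outside far))
      ≡⟨ odd-+ (pair + diagonal + sumF (outside mixed)) (sumF (outside far)) ⟩
    odd (pair + diagonal + sumF (outside mixed)) xor odd (sumF (outside far))
      ≡⟨ cong₂ _xor_ (odd-+ (pair + diagonal) (sumF (outside mixed))) (odd-sumF _ odd-far) ⟩
    (odd (pair + diagonal) xor odd (sumF (outside mixed))) xor false
      ≡⟨ cong₂ (λ a b → (a xor b) xor false) (odd-+ pair diagonal) (odd-sumF _ odd-mixed) ⟩
    ((odd pair xor odd diagonal) xor false) xor false
      ≡⟨ cong₂ (λ a b → ((a xor b) xor false) xor false) odd-pair odd-diagonal ⟩
    true ∎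
    where open ≡-Reasoning

open TranspositionParity using (odd-inversions-transpose)

sgn-transpose : (f : Fin n → Fin n) → (∀ i j → f i ≡ f j → i ≡ j) → {x y : Fin n} → x ≢ y →
                sgn (f ∘ transpose x y) ≡ - sgn f
sgn-transpose f f-injective {x} {y} x≢y with <-cmp x y
... | tri< x<y _ _ = sgn-opposite (f ∘ transpose x y) f (odd-inversions-transpose f f-injective x<y)
... | tri≈ _ x≡y _ = ⊥-elim (x≢y x≡y)
... | tri> _ _ y<x = trans (sgn-cong (cong f ∘ transpose-comm x y))
                           (sgn-opposite (f ∘ transpose y x) f (odd-inversions-transpose f f-injective y<x))

infix 30 _ᵀ

_ᵀ : Grid n → Grid n
(U ᵀ) r c = U c r

NearestAbove : Grid n → Fin n → Fin n → Fin n → Set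
NearestAbove U r c ρ = ρ < r × U ρ c ≡ true × (∀ j → ρ < j → j < r → U j c ≡ false)

module _ (U : Grid n) where

  dotAbove-true⁺ : ∀ {r c} r' → r' < r → U r' c ≡ true → dotAbove U r c ≡ true
  dotAbove-true⁺ r' r'<r u = anyF-true⁺ _ r' (∧-true (<ᶠ-true r'<r) u)

  dotAbove-true⁻ : ∀ {r c} → dotAbove U r c ≡ true → ∃[ r' ] r' < r × U r' c ≡ true
  dotAbove-true⁻ {r} e with anyF-true⁻ _ e
  ... | r' , d = r' , <ᶠ-true⁻ (∧-trueˡ d) , ∧-trueʳ {r' <ᶠ r} d

  dotAbove-false⁺ : ∀ {r c} → (∀ r' → r' < r → U r' c ≡ false) → dotAbove U r c ≡ false
  dotAbove-false⁺ none = ¬-not λ e → let (r' , r'<r , u) = dotAbove-true⁻ e in not-¬ u (none r' r'<r)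

  dotAbove-false⁻ : ∀ {r c} → dotAbove U r c ≡ false → ∀ r' → r' < r → U r' c ≡ false
  dotAbove-false⁻ e r' r'<r = ¬-not λ u → not-¬ (dotAbove-true⁺ r' r'<r u) e

  dotBelow-true⁺ : ∀ {r c} r' → r < r' → U r' c ≡ true → dotBelow U r c ≡ true
  dotBelow-true⁺ r' r<r' u = anyF-true⁺ _ r' (∧-true (<ᶠ-true r<r') u)

  dotBelow-true⁻ : ∀ {r c} → dotBelow U r c ≡ true → ∃[ r' ] r < r' × U r' c ≡ true
  dotBelow-true⁻ {r} e with anyF-true⁻ _ e
  ... | r' , d = r' , <ᶠ-true⁻ (∧-trueˡ d) , ∧-trueʳ {r <ᶠ r'} d

  dotBelow-false⁺ : ∀ {r c} → (∀ r' → r < r' → U r' c ≡ false) → dotBelow U r c ≡ false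
  dotBelow-false⁺ none = ¬-not λ e → let (r' , r<r' , u) = dotBelow-true⁻ e in not-¬ u (none r' r<r')

  dotBelow-false⁻ : ∀ {r c} → dotBelow U r c ≡ false → ∀ r' → r < r' → U r' c ≡ false
  dotBelow-false⁻ e r' r<r' = ¬-not λ u → not-¬ (dotBelow-true⁺ r' r<r' u) e

  parentRow-just⁺ : ∀ {r c} ρ → NearestAbove U r c ρ → parentRow U r c ≡ just ρ
  parentRow-just⁺ {r} {c} ρ (ρ<r , uρ , gap) = findLast-just⁺ _ ρ (if-true (∧-true (<ᶠ-true ρ<r) uρ) , later)
    where
    later : ∀ j → ρ < j → (if (j <ᶠ r) ∧ U j c then just j else nothing) ≡ nothing
    later j ρ<j with <-cmp j r
    ... | tri< j<r _ _ rewrite gap j ρ<j j<r = if-false (∧-zeroʳ (j <ᶠ r))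
    ... | tri≈ _ refl _ rewrite <ᶠ-irrefl j = refl
    ... | tri> _ _ r<j rewrite <ᶠ-false (<-asym r<j) = refl

  parentRow-just⁻ : ∀ {r c ρ} → parentRow U r c ≡ just ρ → NearestAbove U r c ρ
  parentRow-just⁻ {r} {c} e with findLast-just⁻ _ e
  ... | i , eᵢ , later with if-just⁻ ((i <ᶠ r) ∧ U i c) eᵢ
  ...   | ok , refl = <ᶠ-true⁻ (∧-trueˡ ok) , ∧-trueʳ {i <ᶠ r} ok , gap
    where
    gap : ∀ j → i < j → j < r → U j c ≡ false
    gap j i<j j<r = ¬-not λ u → just≢nothing (trans (sym (if-true (∧-true (<ᶠ-true j<r) u))) (later j i<j))

  parentRow-exists : ∀ {r c} → dotAbove U r c ≡ true → ∃[ ρ ] parentRow U r c ≡ just ρ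
  parentRow-exists {r} {c} e with parentRow U r c in eq | dotAbove-true⁻ e
  ... | just ρ | _ = ρ , refl
  ... | nothing | r' , r'<r , u =
    ⊥-elim (just≢nothing (trans (sym (if-true (∧-true (<ᶠ-true {i = r'} {j = r} r'<r) u))) (findLast-nothing⁻ _ eq r')))

  isLeaf-true⁻ : ∀ {r c} → isLeaf U r c ≡ true →
                 U r c ≡ true × dotBelow U r c ≡ false × dotRight U r c ≡ false
  isLeaf-true⁻ {r} {c} e =
    ∧-trueˡ e , not-true⁻ (∧-trueˡ (∧-trueʳ {U r c} e)) , not-true⁻ (∧-trueʳ {not (dotBelow U r c)} (∧-trueʳ {U r c} e))

  isLeaf-true⁺ : ∀ {r c} → U r c ≡ true → dotBelow U r c ≡ false → dotRight U r c ≡ false → isLeaf U r c ≡ true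
  isLeaf-true⁺ u b d rewrite u | b | d = refl

  leaf-unique-in-column : ∀ {r r' c} → isLeaf U r c ≡ true → isLeaf U r' c ≡ true → r ≡ r'
  leaf-unique-in-column {r} {r'} l l' with isLeaf-true⁻ l | isLeaf-true⁻ l' | <-cmp r r'
  ... | _ , below , _ | u' , _ | tri< r<r' _ _ = ⊥-elim (not-¬ u' (dotBelow-false⁻ below r' r<r'))
  ... | _ | _ | tri≈ _ r≡r' _ = r≡r'
  ... | u , _ | _ , below' , _ | tri> _ _ r'<r = ⊥-elim (not-¬ u (dotBelow-false⁻ below' r r'<r))

  isLeaf-in-column : ∀ {r₀ c} → isLeaf U r₀ c ≡ true → ∀ r → isLeaf U r c ≡ (r ≡ᶠ r₀)
  isLeaf-in-column {r₀} l r with ≡-or-≢ r r₀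
  ... | inj₁ refl = trans l (sym (≡ᶠ-refl r))
  ... | inj₂ r≢r₀ = trans (¬-not λ l' → r≢r₀ (leaf-unique-in-column l' l)) (sym (≡ᶠ-false r≢r₀))

  perm-leaf : ∀ {r i} → isLeaf U r i ≡ true → perm U i ≡ r
  perm-leaf {r} {i} l = cong (fromMaybe i) (findLast-just⁺ _ r (if-true l , later))
    where
    later : ∀ j → r < j → (if isLeaf U j i then just j else nothing) ≡ nothing
    later j r<j = if-false (¬-not λ l' → <-irrefl (leaf-unique-in-column l l') r<j)

  dotAbove-root : ∀ {r c} → dotAbove U r c ≡ true → toℕ r ≢ 0
  dotAbove-root e r≡0 with dotAbove-true⁻ e
  ... | r' , r'<r , _ = ℕ.n≮0 (subst (toℕ r' ℕ.<_) r≡0 r'<r)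

module _ (U V : Grid n) where

  dotAbove-cong : ∀ {r c c'} → (∀ r' → r' < r → U r' c ≡ V r' c') → dotAbove U r c ≡ dotAbove V r c'
  dotAbove-cong {r} {c} {c'} agree = anyF-cong same
    where
    same : ∀ j → (j <ᶠ r) ∧ U j c ≡ (j <ᶠ r) ∧ V j c'
    same j with <-cmp j r
    ... | tri< j<r _ _ rewrite <ᶠ-true j<r = agree j j<r
    ... | tri≈ _ refl _ rewrite <ᶠ-irrefl j = refl
    ... | tri> _ _ r<j rewrite <ᶠ-false (<-asym r<j) = refl

  dotBelow-cong : ∀ {r c c'} → (∀ r' → r < r' → U r' c ≡ V r' c') → dotBelow U r c ≡ dotBelow V r c'
  dotBelow-cong {r} {c} {c'} agree = anyF-cong same
    where
    same : ∀ j → (r <ᶠ j) ∧ U j c ≡ (r <ᶠ j) ∧ V j c'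
    same j with <-cmp r j
    ... | tri< r<j _ _ rewrite <ᶠ-true r<j = agree j r<j
    ... | tri≈ _ refl _ rewrite <ᶠ-irrefl r = refl
    ... | tri> _ _ j<r rewrite <ᶠ-false (<-asym j<r) = refl

  parentRow-cong : ∀ {r c c'} → (∀ r' → r' < r → U r' c ≡ V r' c') → parentRow U r c ≡ parentRow V r c'
  parentRow-cong {r} {c} {c'} agree = findLast-cong same
    where
    same : ∀ j → (if (j <ᶠ r) ∧ U j c then just j else nothing) ≡ (if (j <ᶠ r) ∧ V j c' then just j else nothing)
    same j with <-cmp j r
    ... | tri< j<r _ _ rewrite <ᶠ-true j<r | agree j j<r = refl
    ... | tri≈ _ refl _ rewrite <ᶠ-irrefl j = refl
    ... | tri> _ _ r<j rewrite <ᶠ-false (<-asym r<j) = refl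

isLeaf-ᵀ : (U : Grid n) (r c : Fin n) → isLeaf (U ᵀ) r c ≡ isLeaf U c r
isLeaf-ᵀ U r c = cong (U c r ∧_) (∧-comm (not (dotRight U c r)) (not (dotBelow U c r)))

isLeftLeaf-ᵀ : (U : Grid n) (r c : Fin n) → isLeftLeaf (U ᵀ) r c ≡ isRightLeaf U c r
isLeftLeaf-ᵀ U r c = cong (_∧ dotLeft U c r) (isLeaf-ᵀ U r c)

isRightLeaf-ᵀ : (U : Grid n) (r c : Fin n) → isRightLeaf (U ᵀ) r c ≡ isLeftLeaf U c r
isRightLeaf-ᵀ U r c = cong (_∧ dotAbove U c r) (isLeaf-ᵀ U r c)

between-indep : (U V : Grid n) (m : Maybe (Fin n)) (a b : Fin n) → between U m a b ≡ between V m a b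
between-indep U V (just _) a b = refl
between-indep U V nothing a b = refl

adjacent-indep : (U V : Grid n) (m : Maybe (Fin n)) (a : Fin n) → adjacent U m a ≡ adjacent V m a
adjacent-indep U V (just _) a = refl
adjacent-indep U V nothing a = refl

flip² : Cell n × Cell n → Cell n × Cell n
flip² ((a , b) , (c , d)) = (b , a) , (d , c)

map-flip²-just⁻ : ∀ {m : Maybe (Cell n × Cell n)} {p} → Maybe.map flip² m ≡ just p → m ≡ just (flip² p)
map-flip²-just⁻ {m = just ((a , b) , (c , d))} refl = refl

map-flip²-nothing⁻ : ∀ {m : Maybe (Cell n × Cell n)} → Maybe.map flip² m ≡ nothing → m ≡ nothing
map-flip²-nothing⁻ {m = nothing} _ = refl

interactingLeft-ᵀ : (U : Grid n) (a b c d : Fin n) →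
                    interactingLeft (U ᵀ) (a , b) (c , d) ≡ interactingRight U (b , a) (d , c)
interactingLeft-ᵀ U a b c d =
  cong₂ _∧_ (isLeftLeaf-ᵀ U a b) (cong₂ _∧_ (isLeftLeaf-ᵀ U c d)
    (cong₂ _∨_ (between-indep (U ᵀ) U (parentCol U b a) c a) (between-indep (U ᵀ) U (parentCol U d c) a c)))

interactingRight-ᵀ : (U : Grid n) (a b c d : Fin n) →
                     interactingRight (U ᵀ) (a , b) (c , d) ≡ interactingLeft U (b , a) (d , c)
interactingRight-ᵀ U a b c d =
  cong₂ _∧_ (isRightLeaf-ᵀ U a b) (cong₂ _∧_ (isRightLeaf-ᵀ U c d)
    (cong₂ _∨_ (between-indep (U ᵀ) U (parentRow U b a) d b) (between-indep (U ᵀ) U (parentRow U d c) b d)))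

maxInteractingRight-ᵀ : (U : Grid n) → maxInteractingRight U ≡ Maybe.map flip² (maxInteractingLeft (U ᵀ))
maxInteractingRight-ᵀ {n} U = sym (
  trans (sym (findLast-map flip² level₁)) (findLast-cong λ a →
  trans (sym (findLast-map flip² (level₂ a))) (findLast-cong λ c →
  trans (sym (findLast-map flip² (level₃ a c))) (findLast-cong λ b →
  trans (sym (findLast-map flip² (candidate a c b))) (findLast-cong λ d →
  trans (map-if (interactingLeft (U ᵀ) (a , b) (c , d)))
        (cong (λ z → if z then just ((b , a) , (d , c)) else nothing) (interactingLeft-ᵀ U a b c d)))))))
  where
  candidate : Fin n → Fin n → Fin n → Fin n → Maybe (Cell n × Cell n)
  candidate a c b d = if interactingLeft (U ᵀ) (a , b) (c , d) then just ((a , b) , (c , d)) else nothing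
  level₃ : Fin n → Fin n → Fin n → Maybe (Cell n × Cell n)
  level₃ a c b = findLast (candidate a c b)
  level₂ : Fin n → Fin n → Maybe (Cell n × Cell n)
  level₂ a c = findLast (level₃ a c)
  level₁ : Fin n → Maybe (Cell n × Cell n)
  level₁ a = findLast (level₂ a)
  map-if : ∀ z {v} → Maybe.map flip² (if z then just v else nothing) ≡ (if z then just (flip² v) else nothing)
  map-if true = refl
  map-if false = refl

switch-ᵀ : (U : Grid n) (r₁ c₁ r₂ c₂ : Fin n) → switch U (r₁ , c₁) (r₂ , c₂) ≋ (switch (U ᵀ) (c₁ , r₁) (c₂ , r₂)) ᵀ
switch-ᵀ U r₁ c₁ r₂ c₂ r c = same (r ≡ᶠ r₂) (c ≡ᶠ c₁) (r ≡ᶠ r₁) (c ≡ᶠ c₂)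
  where
  same : ∀ a b p q → (if (a ∧ b) ∨ (p ∧ q) then true else if (p ∧ b) ∨ (a ∧ q) then false else U r c)
                   ≡ (if (q ∧ p) ∨ (b ∧ a) then true else if (b ∧ p) ∨ (q ∧ a) then false else U r c)
  same a b p q rewrite ∧-comm a b | ∧-comm p q | ∨-comm (b ∧ a) (q ∧ p)
                     | ∧-comm p b | ∧-comm a q | ∨-comm (b ∧ p) (q ∧ a) = refl

IsCNAT-ᵀ : (U : Grid n) → IsCNAT U → IsCNAT (U ᵀ)
IsCNAT-ᵀ U cn = record
  { nat = record
    { root = λ r c r≡0 c≡0 → IsNAT.root nat c r c≡0 r≡0
    ; parent = λ r c d nonroot → trans (xor-comm (dotLeft U c r) (dotAbove U c r))
                                       (IsNAT.parent nat c r d λ (c≡0 , r≡0) → nonroot (r≡0 , c≡0))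
    ; rowDot = IsNAT.colDot nat
    ; colDot = IsNAT.rowDot nat }
  ; complete = λ r c d → subst (_≡ true)
      (cong₂ _∨_ (∧-comm (dotBelow U c r) (dotRight U c r)) (∧-comm (not (dotBelow U c r)) (not (dotRight U c r))))
      (IsCNAT.complete cn c r d) }
  where
  open IsCNAT cn using (nat)

leaf-unique-in-row : (U : Grid n) → ∀ {r c c'} → isLeaf U r c ≡ true → isLeaf U r c' ≡ true → c ≡ c'
leaf-unique-in-row U {r} {c} {c'} l l' =
  leaf-unique-in-column (U ᵀ) (trans (isLeaf-ᵀ U c r) l) (trans (isLeaf-ᵀ U c' r) l')

module _ (U : Grid n) (cn : IsCNAT U) where
  open IsCNAT cn using (nat; complete)

  dotBelow≡dotRight : ∀ {r c} → U r c ≡ true → dotBelow U r c ≡ dotRight U r c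
  dotBelow≡dotRight {r} {c} d = internal-or-leaf (dotBelow U r c) (dotRight U r c) (complete r c d)
    where
    internal-or-leaf : ∀ a b → (a ∧ b) ∨ (not a ∧ not b) ≡ true → a ≡ b
    internal-or-leaf true true _ = refl
    internal-or-leaf false false _ = refl

  -- the rightmost dot of a row is a leaf
  leaf-in-row : ∀ r → ∃[ c ] isLeaf U r c ≡ true
  leaf-in-row r with findLast (λ c → if U r c then just c else nothing) in eq | IsNAT.rowDot nat r
  ... | nothing | c₀ , d₀ = ⊥-elim (just≢nothing (trans (sym (if-true d₀)) (findLast-nothing⁻ _ eq c₀)))
  ... | just c | _ with findLast-just⁻ _ eq
  ...   | i , eᵢ , later with if-just⁻ (U r i) eᵢ
  ...     | u , refl = c , isLeaf-true⁺ U u (trans (dotBelow≡dotRight u) no-right) no-right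
    where
    no-right : dotRight U r c ≡ false
    no-right = dotBelow-false⁺ (U ᵀ) λ c' c<c' → ¬-not λ u' → just≢nothing (trans (sym (if-true u')) (later c' c<c'))

  leaf-left-or-right : ∀ {r c} → isLeaf U r c ≡ true → ¬ (toℕ r ≡ 0 × toℕ c ≡ 0) →
                       isLeftLeaf U r c ≡ true ⊎ isRightLeaf U r c ≡ true
  leaf-left-or-right {r} {c} l nonroot =
    exactly-one (dotAbove U r c) (dotLeft U r c) refl refl (IsNAT.parent nat r c (proj₁ (isLeaf-true⁻ U l)) nonroot)
    where
    exactly-one : ∀ a b → dotAbove U r c ≡ a → dotLeft U r c ≡ b → a xor b ≡ true →
                  isLeftLeaf U r c ≡ true ⊎ isRightLeaf U r c ≡ true
    exactly-one true false above _ _ = inj₁ (∧-true l above)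
    exactly-one false true _ left _ = inj₂ (∧-true l left)

  leftLeaf-dotLeft : ∀ {r c} → isLeftLeaf U r c ≡ true → dotLeft U r c ≡ false
  leftLeaf-dotLeft {r} {c} ll = not-both (dotAbove U r c) (dotLeft U r c) above
    (IsNAT.parent nat r c (proj₁ (isLeaf-true⁻ U (∧-trueˡ ll))) λ (r≡0 , _) → dotAbove-root U above r≡0)
    where
    above : dotAbove U r c ≡ true
    above = ∧-trueʳ {isLeaf U r c} ll
    not-both : ∀ a b → a ≡ true → a xor b ≡ true → b ≡ false
    not-both true false _ _ = refl

  leftLeaf-alone-in-row : ∀ {r c} → isLeftLeaf U r c ≡ true → ∀ c' → c' ≢ c → U r c' ≡ false
  leftLeaf-alone-in-row {r} {c} ll c' c'≢c with <-cmp c' c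
  ... | tri< c'<c _ _ = dotAbove-false⁻ (U ᵀ) (leftLeaf-dotLeft ll) c' c'<c
  ... | tri≈ _ c'≡c _ = ⊥-elim (c'≢c c'≡c)
  ... | tri> _ _ c<c' = dotBelow-false⁻ (U ᵀ) (proj₂ (proj₂ (isLeaf-true⁻ U (∧-trueˡ ll)))) c' c<c'

leaf-in-column : (U : Grid n) → IsCNAT U → ∀ c → ∃[ r ] isLeaf U r c ≡ true
leaf-in-column U cn c with leaf-in-row (U ᵀ) (IsCNAT-ᵀ U cn) c
... | r , l = r , trans (sym (isLeaf-ᵀ U c r)) l

perm-injective : (U : Grid n) → IsCNAT U → ∀ i j → perm U i ≡ perm U j → i ≡ j
perm-injective U cn i j e with leaf-in-column U cn i | leaf-in-column U cn j
... | rᵢ , lᵢ | rⱼ , lⱼ rewrite perm-leaf U lᵢ | perm-leaf U lⱼ | e = leaf-unique-in-row U lᵢ lⱼ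

perm-along : (U V : Grid n) → IsCNAT U → (σ : Fin n → Fin n) →
             (∀ r c → isLeaf V r c ≡ isLeaf U r (σ c)) → ∀ i → perm V i ≡ perm U (σ i)
perm-along U V cn σ leaves i with leaf-in-column U cn (σ i)
... | r , l = trans (perm-leaf V (trans (leaves r i) l)) (sym (perm-leaf U l))

LongLeftLeaf : Grid n → Fin n → Fin n → Set
LongLeftLeaf V r c = isLeftLeaf V r c ≡ true × adjacent V (parentRow V r c) r ≡ false

module _ {V W : Grid n} (V≋W : V ≋ W) where

  dotAbove-≋ : ∀ r c → dotAbove V r c ≡ dotAbove W r c
  dotAbove-≋ r c = dotAbove-cong V W {r} λ r' _ → V≋W r' c

  dotBelow-≋ : ∀ r c → dotBelow V r c ≡ dotBelow W r c
  dotBelow-≋ r c = dotBelow-cong V W {r} λ r' _ → V≋W r' c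

  dotLeft-≋ : ∀ r c → dotLeft V r c ≡ dotLeft W r c
  dotLeft-≋ r c = dotAbove-cong (V ᵀ) (W ᵀ) {c} λ c' _ → V≋W r c'

  dotRight-≋ : ∀ r c → dotRight V r c ≡ dotRight W r c
  dotRight-≋ r c = dotBelow-cong (V ᵀ) (W ᵀ) {c} λ c' _ → V≋W r c'

  isLeaf-≋ : ∀ r c → isLeaf V r c ≡ isLeaf W r c
  isLeaf-≋ r c = cong₂ _∧_ (V≋W r c) (cong₂ (λ b d → not b ∧ not d) (dotBelow-≋ r c) (dotRight-≋ r c))

  isLeftLeaf-≋ : ∀ r c → isLeftLeaf V r c ≡ isLeftLeaf W r c
  isLeftLeaf-≋ r c = cong₂ _∧_ (isLeaf-≋ r c) (dotAbove-≋ r c)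

  parentRow-≋ : ∀ r c → parentRow V r c ≡ parentRow W r c
  parentRow-≋ r c = parentRow-cong V W {r} λ r' _ → V≋W r' c

  interactingLeft-≋ : ∀ x y → interactingLeft V x y ≡ interactingLeft W x y
  interactingLeft-≋ (a , b) (c , d) = cong₂ _∧_ (isLeftLeaf-≋ a b) (cong₂ _∧_ (isLeftLeaf-≋ c d)
    (cong₂ _∨_ (between-≋ (parentRow-≋ a b)) (between-≋ (parentRow-≋ c d))))
    where
    between-≋ : ∀ {m m' x y} → m ≡ m' → between V m x y ≡ between W m' x y
    between-≋ {m} {x = x} {y} refl = between-indep V W m x y

  LongLeftLeaf-≋ : ∀ {r c} → LongLeftLeaf W r c → LongLeftLeaf V r c
  LongLeftLeaf-≋ {r} {c} (ll , long) =
    trans (isLeftLeaf-≋ r c) ll ,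
    trans (cong (λ m → adjacent V m r) (parentRow-≋ r c)) (trans (adjacent-indep V W (parentRow W r c) r) long)

  switch-≋ : ∀ l₁ l₂ → switch V l₁ l₂ ≋ switch W l₁ l₂
  switch-≋ (r₁ , c₁) (r₂ , c₂) r c = cong (λ z → if ((r ≡ᶠ r₂) ∧ (c ≡ᶠ c₁)) ∨ ((r ≡ᶠ r₁) ∧ (c ≡ᶠ c₂)) then true
      else if ((r ≡ᶠ r₁) ∧ (c ≡ᶠ c₁)) ∨ ((r ≡ᶠ r₂) ∧ (c ≡ᶠ c₂)) then false else z) (V≋W r c)

  IsCNAT-≋ : IsCNAT W → IsCNAT V
  IsCNAT-≋ cn = record
    { nat = record
      { root = λ r c r≡0 c≡0 → trans (V≋W r c) (IsNAT.root nat r c r≡0 c≡0)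
      ; parent = λ r c d nonroot → trans (cong₂ _xor_ (dotAbove-≋ r c) (dotLeft-≋ r c))
                                         (IsNAT.parent nat r c (trans (sym (V≋W r c)) d) nonroot)
      ; rowDot = λ r → let (c , d) = IsNAT.rowDot nat r in c , trans (V≋W r c) d
      ; colDot = λ c → let (r , d) = IsNAT.colDot nat c in r , trans (V≋W r c) d }
    ; complete = λ r c d → trans (cong₂ (λ b d → (b ∧ d) ∨ (not b ∧ not d)) (dotBelow-≋ r c) (dotRight-≋ r c))
                                 (IsCNAT.complete cn r c (trans (sym (V≋W r c)) d)) }
    where
    open IsCNAT cn using (nat)

maxInteractingLeft-cong : (V W : Grid n) → (∀ x y → interactingLeft V x y ≡ interactingLeft W x y) →
                          maxInteractingLeft V ≡ maxInteractingLeft W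
maxInteractingLeft-cong V W same = findLast-cong λ a → findLast-cong λ b → findLast-cong λ c → findLast-cong λ d →
  cong (λ z → if z then just ((a , c) , (b , d)) else nothing) (same (a , c) (b , d))

between-true⁻ : (V : Grid n) (m : Maybe (Fin n)) (a b : Fin n) → between V m a b ≡ true →
                ∃[ p ] m ≡ just p × p < a × a < b
between-true⁻ V (just p) a b e = p , refl , <ᶠ-true⁻ (∧-trueˡ e) , <ᶠ-true⁻ (∧-trueʳ {p <ᶠ a} e)

between-true⁺ : (V : Grid n) {m : Maybe (Fin n)} (p a b : Fin n) → m ≡ just p → p < a → a < b → between V m a b ≡ true
between-true⁺ V p a b refl p<a a<b = ∧-true (<ᶠ-true p<a) (<ᶠ-true a<b)

module _ (V : Grid n) where

  interactingLeft-true⁺ : ∀ {r₁ c₁ r₂ c₂} ρ → isLeftLeaf V r₁ c₁ ≡ true → isLeftLeaf V r₂ c₂ ≡ true →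
    parentRow V r₁ c₁ ≡ just ρ → ρ < r₂ → r₂ < r₁ → interactingLeft V (r₁ , c₁) (r₂ , c₂) ≡ true
  interactingLeft-true⁺ {r₁} ρ ll₁ ll₂ pr ρ<r₂ r₂<r₁ =
    ∧-true ll₁ (∧-true ll₂ (∨-trueˡ _ (between-true⁺ V ρ _ r₁ pr ρ<r₂ r₂<r₁)))

  interactingLeft-sym : ∀ x y → interactingLeft V x y ≡ true → interactingLeft V y x ≡ true
  interactingLeft-sym (r₁ , c₁) (r₂ , c₂) = swap (isLeftLeaf V r₁ c₁) (isLeftLeaf V r₂ c₂)
    (between V (parentRow V r₁ c₁) r₂ r₁) (between V (parentRow V r₂ c₂) r₁ r₂)
    where
    swap : ∀ a b p q → a ∧ (b ∧ (p ∨ q)) ≡ true → b ∧ (a ∧ (q ∨ p)) ≡ true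
    swap true true p q e = trans (∨-comm q p) e

  interactingLeft-true⁻ : ∀ {r₁ c₁ r₂ c₂} → interactingLeft V (r₁ , c₁) (r₂ , c₂) ≡ true →
    isLeftLeaf V r₁ c₁ ≡ true × isLeftLeaf V r₂ c₂ ≡ true ×
    (between V (parentRow V r₁ c₁) r₂ r₁ ≡ true ⊎ between V (parentRow V r₂ c₂) r₁ r₂ ≡ true)
  interactingLeft-true⁻ {r₁} {c₁} {r₂} {c₂} e =
    ∧-trueˡ e , ∧-trueˡ (∧-trueʳ {isLeftLeaf V r₁ c₁} e) ,
    ∨-true⁻ (∧-trueʳ {isLeftLeaf V r₂ c₂} (∧-trueʳ {isLeftLeaf V r₁ c₁} e))

  interactingLeft-ordered : ∀ {r₁ c₁ r₂ c₂} → interactingLeft V (r₁ , c₁) (r₂ , c₂) ≡ true → r₂ < r₁ →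
                            ∃[ ρ ] parentRow V r₁ c₁ ≡ just ρ × ρ < r₂
  interactingLeft-ordered {r₁} {c₁} {r₂} {c₂} e r₂<r₁ with proj₂ (proj₂ (interactingLeft-true⁻ e))
  ... | inj₁ b with between-true⁻ V (parentRow V r₁ c₁) r₂ r₁ b
  ...   | ρ , pr , ρ<r₂ , _ = ρ , pr , ρ<r₂
  interactingLeft-ordered {r₁} {c₁} {r₂} {c₂} e r₂<r₁ | inj₂ b with between-true⁻ V (parentRow V r₂ c₂) r₁ r₂ b
  ... | _ , _ , _ , r₁<r₂ = ⊥-elim (<-asym r₁<r₂ r₂<r₁)

LexMaxLeft : Grid n → Cell n → Cell n → Set
LexMaxLeft V (r₁ , _) (r₂ , _) = ∀ x y → interactingLeft V x y ≡ true →
  ¬ r₁ < proj₁ x × (proj₁ x ≡ r₁ → ¬ r₂ < proj₁ y)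

module _ (V : Grid n) where

  private
    candidate : Fin n → Fin n → Fin n → Fin n → Maybe (Cell n × Cell n)
    candidate r₁ r₂ c₁ c₂ = if interactingLeft V (r₁ , c₁) (r₂ , c₂) then just ((r₁ , c₁) , (r₂ , c₂)) else nothing

    not-candidate : ∀ {r₁ r₂ c₁ c₂} → ¬ interactingLeft V (r₁ , c₁) (r₂ , c₂) ≡ true → candidate r₁ r₂ c₁ c₂ ≡ nothing
    not-candidate ¬i = if-false (¬-not ¬i)

    same-row-same-leaf : ∀ {r c c'} → isLeftLeaf V r c ≡ true → isLeftLeaf V r c' ≡ true → ¬ c < c'
    same-row-same-leaf ll ll' c<c' = <-irrefl (leaf-unique-in-row V (∧-trueˡ ll) (∧-trueˡ ll')) c<c'

  maxInteractingLeft-just⁺ : ∀ a b → interactingLeft V a b ≡ true → LexMaxLeft V a b →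
                             maxInteractingLeft V ≡ just (a , b)
  maxInteractingLeft-just⁺ (r₁ , c₁) (r₂ , c₂) i max = findLast-just⁺ _ r₁ (at-r₁ ,
      λ r r₁<r → findLast-nothing⁺ _ λ r' → findLast-nothing⁺ _ λ c → findLast-nothing⁺ _ λ c' →
        not-candidate λ i' → proj₁ (max (r , c) (r' , c') i') r₁<r)
    where
    ll₁ : isLeftLeaf V r₁ c₁ ≡ true
    ll₁ = proj₁ (interactingLeft-true⁻ V i)
    ll₂ : isLeftLeaf V r₂ c₂ ≡ true
    ll₂ = proj₁ (proj₂ (interactingLeft-true⁻ V i))
    at-c₁ : findLast (λ c → findLast (candidate r₁ r₂ c)) ≡ just ((r₁ , c₁) , (r₂ , c₂))
    at-c₁ = findLast-just⁺ _ c₁ (findLast-just⁺ _ c₂ (if-true i ,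
        λ c c₂<c → not-candidate λ i' → same-row-same-leaf ll₂ (proj₁ (proj₂ (interactingLeft-true⁻ V i'))) c₂<c) ,
      λ c c₁<c → findLast-nothing⁺ (candidate r₁ r₂ c) λ c' →
        not-candidate λ i' → same-row-same-leaf ll₁ (proj₁ (interactingLeft-true⁻ V i')) c₁<c)
    at-r₁ : findLast (λ r' → findLast λ c → findLast (candidate r₁ r' c)) ≡ just ((r₁ , c₁) , (r₂ , c₂))
    at-r₁ = findLast-just⁺ _ r₂ (at-c₁ , λ r' r₂<r' → findLast-nothing⁺ _ λ c → findLast-nothing⁺ _ λ c' →
      not-candidate λ i' → proj₂ (max (r₁ , c) (r' , c') i') refl r₂<r')

  maxInteractingLeft-just⁻ : ∀ {a b} → maxInteractingLeft V ≡ just (a , b) →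
                             interactingLeft V a b ≡ true × LexMaxLeft V a b
  maxInteractingLeft-just⁻ {a} {b} e with findLast-just⁻ _ e
  ... | r₁ , e₁ , later₁ with findLast-just⁻ _ e₁
  ... | r₂ , e₂ , later₂ with findLast-just⁻ _ e₂
  ... | c₁ , e₃ , _ with findLast-just⁻ _ e₃
  ... | c₂ , e₄ , _ with if-just⁻ (interactingLeft V (r₁ , c₁) (r₂ , c₂)) e₄
  ... | i , refl = i , λ (r , c) (r' , c') i' →
          (λ r₁<r → excluded i' (lower (findLast-nothing⁻ _ (later₁ r r₁<r) r') c c')) ,
          (λ { refl r₂<r' → excluded i' (lower (later₂ r' r₂<r') c c') })
    where
    lower : ∀ {r r'} → findLast (λ c → findLast (candidate r r' c)) ≡ nothing → ∀ c c' → candidate r r' c c' ≡ nothing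
    lower e c c' = findLast-nothing⁻ _ (findLast-nothing⁻ _ e c) c'
    excluded : ∀ {r r' c c'} → interactingLeft V (r , c) (r' , c') ≡ true → candidate r r' c c' ≡ nothing → ⊥
    excluded i' e = just≢nothing (trans (sym (if-true i')) e)

  maxInteractingLeft-nothing⁻ : maxInteractingLeft V ≡ nothing → ∀ x y → interactingLeft V x y ≡ false
  maxInteractingLeft-nothing⁻ e (r , c) (r' , c') = if-nothing⁻ _
    (findLast-nothing⁻ _ (findLast-nothing⁻ _ (findLast-nothing⁻ _ (findLast-nothing⁻ _ e r) r') c) c')

  lexMax-rows : ∀ {r₁ c₁ r₂ c₂} → interactingLeft V (r₁ , c₁) (r₂ , c₂) ≡ true → LexMaxLeft V (r₁ , c₁) (r₂ , c₂) →
                r₂ < r₁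
  lexMax-rows {r₁} {c₁} {r₂} {c₂} i max with <-cmp r₂ r₁
  ... | tri< r₂<r₁ _ _ = r₂<r₁
  ... | tri> _ _ r₁<r₂ = ⊥-elim (proj₁ (max (r₂ , c₂) (r₁ , c₁) (interactingLeft-sym V _ _ i)) r₁<r₂)
  ... | tri≈ _ refl _ with proj₂ (proj₂ (interactingLeft-true⁻ V i))
  ...   | inj₁ b = let (_ , _ , _ , r<r) = between-true⁻ V (parentRow V r₁ c₁) r₁ r₁ b in ⊥-elim (<-irrefl refl r<r)
  ...   | inj₂ b = let (_ , _ , _ , r<r) = between-true⁻ V (parentRow V r₁ c₂) r₁ r₁ b in ⊥-elim (<-irrefl refl r<r)

maxInteractingRight-nothing⁻ : (V : Grid n) → maxInteractingRight V ≡ nothing → ∀ x y → interactingRight V x y ≡ false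
maxInteractingRight-nothing⁻ V e (r , c) (r' , c') =
  trans (sym (interactingLeft-ᵀ V c r c' r'))
        (maxInteractingLeft-nothing⁻ (V ᵀ) (map-flip²-nothing⁻ (trans (sym (maxInteractingRight-ᵀ V)) e)) (c , r) (c' , r'))

module _ (V : Grid n) where

  Φ-allShort : allShort V ≡ true → Φ V ≡ V
  Φ-allShort e with allShort V
  Φ-allShort refl | true = refl

  Φ-left : ∀ {l₁ l₂} → allShort V ≡ false → maxInteractingLeft V ≡ just (l₁ , l₂) → Φ V ≡ switch V l₁ l₂
  Φ-left e₁ e₂ with allShort V
  Φ-left refl e₂ | false with maxInteractingLeft V
  Φ-left refl refl | false | just _ = refl

  Φ-right : ∀ {l₁ l₂} → allShort V ≡ false → maxInteractingLeft V ≡ nothing →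
            maxInteractingRight V ≡ just (l₁ , l₂) → Φ V ≡ switch V l₁ l₂
  Φ-right e₁ e₂ e₃ with allShort V
  Φ-right refl e₂ e₃ | false with maxInteractingLeft V
  Φ-right refl refl e₃ | false | nothing with maxInteractingRight V
  Φ-right refl refl refl | false | nothing | just _ = refl

module _ (V : Grid n) where

  private
    allShort-false⁺ : ∀ r c → isLeaf V r c ≡ true → isShortLeaf V r c ≡ false → allShort V ≡ false
    allShort-false⁺ r c l s = allF-false⁺ _ r (allF-false⁺ _ c (cong₂ (λ a b → not a ∨ b) l s))

  longLeftLeaf⇒¬allShort : ∀ {r c} → LongLeftLeaf V r c → allShort V ≡ false
  longLeftLeaf⇒¬allShort {r} {c} (ll , long) =
    allShort-false⁺ r c (∧-trueˡ ll) (trans (if-true ll) long)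

  longRightLeaf⇒¬allShort : ∀ {r c} → isLeftLeaf V r c ≡ false → LongLeftLeaf (V ᵀ) c r → allShort V ≡ false
  longRightLeaf⇒¬allShort {r} {c} ¬ll (llᵀ , long) =
    allShort-false⁺ r c (∧-trueˡ rl) (trans (if-false ¬ll) (trans (if-true rl)
      (trans (adjacent-indep V (V ᵀ) (parentCol V r c) c) long)))
    where
    rl : isRightLeaf V r c ≡ true
    rl = trans (sym (isLeftLeaf-ᵀ V c r)) llᵀ

  private
    notShort⇒long : ∀ r c l a b → isLeftLeaf V r c ≡ a → isRightLeaf V r c ≡ b →
      not l ∨ (if a then adjacent V (parentRow V r c) r else if b then adjacent V (parentCol V r c) c else true) ≡ false →
      LongLeftLeaf V r c ⊎ LongLeftLeaf (V ᵀ) c r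
    notShort⇒long r c true true  _    ll _  long = inj₁ (ll , long)
    notShort⇒long r c true false true _  rl long =
      inj₂ (trans (isLeftLeaf-ᵀ V c r) rl , trans (adjacent-indep (V ᵀ) V (parentCol V r c) c) long)

  ¬allShort⇒longLeaf : allShort V ≡ false → ∃[ r ] ∃[ c ] (LongLeftLeaf V r c ⊎ LongLeftLeaf (V ᵀ) c r)
  ¬allShort⇒longLeaf e with allF-false⁻ _ e
  ... | r , e' with allF-false⁻ _ e'
  ... | c , e'' = r , c , notShort⇒long r c (isLeaf V r c) (isLeftLeaf V r c) (isRightLeaf V r c) refl refl e''

module LeftSwitch (U : Grid n) (cn : IsCNAT U) {r₁ c₁ r₂ c₂ ρ₁ ρ₂ : Fin n}
  (ll₁ : isLeftLeaf U r₁ c₁ ≡ true) (ll₂ : isLeftLeaf U r₂ c₂ ≡ true)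
  (pr₁ : parentRow U r₁ c₁ ≡ just ρ₁) (pr₂ : parentRow U r₂ c₂ ≡ just ρ₂)
  (r₂<r₁ : r₂ < r₁) (ρ₁<r₂ : ρ₁ < r₂) where

  S : Grid n
  S = switch U (r₁ , c₁) (r₂ , c₂)

  private
    nearest₁ : NearestAbove U r₁ c₁ ρ₁
    nearest₁ = parentRow-just⁻ U {r₁} {c₁} pr₁
    nearest₂ : NearestAbove U r₂ c₂ ρ₂
    nearest₂ = parentRow-just⁻ U {r₂} {c₂} pr₂

  ρ₂<r₂ : ρ₂ < r₂
  ρ₂<r₂ = proj₁ nearest₂

  ρ₁<r₁ : ρ₁ < r₁
  ρ₁<r₁ = <-trans ρ₁<r₂ r₂<r₁

  ρ₂<r₁ : ρ₂ < r₁
  ρ₂<r₁ = <-trans ρ₂<r₂ r₂<r₁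

  r₁≢r₂ : r₁ ≢ r₂
  r₁≢r₂ = ≢-sym (<⇒≢ r₂<r₁)

  U₁₁ : U r₁ c₁ ≡ true
  U₁₁ = proj₁ (isLeaf-true⁻ U (∧-trueˡ ll₁))

  U₂₂ : U r₂ c₂ ≡ true
  U₂₂ = proj₁ (isLeaf-true⁻ U (∧-trueˡ ll₂))

  column₁-empty : ∀ j → ρ₁ < j → j ≢ r₁ → U j c₁ ≡ false
  column₁-empty j ρ₁<j j≢r₁ with <-cmp j r₁
  ... | tri< j<r₁ _ _ = proj₂ (proj₂ nearest₁) j ρ₁<j j<r₁
  ... | tri≈ _ j≡r₁ _ = ⊥-elim (j≢r₁ j≡r₁)
  ... | tri> _ _ r₁<j = dotBelow-false⁻ U (proj₁ (proj₂ (isLeaf-true⁻ U (∧-trueˡ ll₁)))) j r₁<j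

  column₂-empty : ∀ j → ρ₂ < j → j ≢ r₂ → U j c₂ ≡ false
  column₂-empty j ρ₂<j j≢r₂ with <-cmp j r₂
  ... | tri< j<r₂ _ _ = proj₂ (proj₂ nearest₂) j ρ₂<j j<r₂
  ... | tri≈ _ j≡r₂ _ = ⊥-elim (j≢r₂ j≡r₂)
  ... | tri> _ _ r₂<j = dotBelow-false⁻ U (proj₁ (proj₂ (isLeaf-true⁻ U (∧-trueˡ ll₂)))) j r₂<j

  row₁-empty : ∀ c → c ≢ c₁ → U r₁ c ≡ false
  row₁-empty = leftLeaf-alone-in-row U cn ll₁

  row₂-empty : ∀ c → c ≢ c₂ → U r₂ c ≡ false
  row₂-empty = leftLeaf-alone-in-row U cn ll₂

  c₁≢c₂ : c₁ ≢ c₂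
  c₁≢c₂ refl = not-¬ U₁₁ (column₂-empty r₁ ρ₂<r₁ r₁≢r₂)

  S-row₁ : ∀ c → S r₁ c ≡ (c ≡ᶠ c₂)
  S-row₁ c rewrite ≡ᶠ-refl r₁ | ≡ᶠ-false r₁≢r₂ with ≡-or-≢ c c₂
  ... | inj₁ refl rewrite ≡ᶠ-refl c = refl
  ... | inj₂ c≢c₂ rewrite ≡ᶠ-false c≢c₂ with ≡-or-≢ c c₁
  ...   | inj₁ refl rewrite ≡ᶠ-refl c = refl
  ...   | inj₂ c≢c₁ rewrite ≡ᶠ-false c≢c₁ = row₁-empty c c≢c₁

  S-row₂ : ∀ c → S r₂ c ≡ (c ≡ᶠ c₁)
  S-row₂ c rewrite ≡ᶠ-refl r₂ | ≡ᶠ-false (≢-sym r₁≢r₂) with ≡-or-≢ c c₁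
  ... | inj₁ refl rewrite ≡ᶠ-refl c = refl
  ... | inj₂ c≢c₁ rewrite ≡ᶠ-false c≢c₁ with ≡-or-≢ c c₂
  ...   | inj₁ refl rewrite ≡ᶠ-refl c = refl
  ...   | inj₂ c≢c₂ rewrite ≡ᶠ-false c≢c₂ = row₂-empty c c≢c₂

  S-other-row : ∀ {r} c → r ≢ r₁ → r ≢ r₂ → S r c ≡ U r c
  S-other-row c r≢r₁ r≢r₂ rewrite ≡ᶠ-false r≢r₁ | ≡ᶠ-false r≢r₂ = refl

  S-other-column : ∀ {c} r → c ≢ c₁ → c ≢ c₂ → S r c ≡ U r c
  S-other-column {c} r c≢c₁ c≢c₂ with ≡-or-≢ r r₁ | ≡-or-≢ r r₂
  ... | inj₁ refl | _ = trans (S-row₁ c) (trans (≡ᶠ-false c≢c₂) (sym (row₁-empty c c≢c₁)))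
  ... | inj₂ _ | inj₁ refl = trans (S-row₂ c) (trans (≡ᶠ-false c≢c₁) (sym (row₂-empty c c≢c₂)))
  ... | inj₂ r≢r₁ | inj₂ r≢r₂ = S-other-row c r≢r₁ r≢r₂

  S₁₂ : S r₁ c₂ ≡ true
  S₁₂ = trans (S-row₁ c₂) (≡ᶠ-refl c₂)

  S₂₁ : S r₂ c₁ ≡ true
  S₂₁ = trans (S-row₂ c₁) (≡ᶠ-refl c₁)

  S₁₁ : S r₁ c₁ ≡ false
  S₁₁ = trans (S-row₁ c₁) (≡ᶠ-false c₁≢c₂)

  S₂₂ : S r₂ c₂ ≡ false
  S₂₂ = trans (S-row₂ c₂) (≡ᶠ-false (≢-sym c₁≢c₂))

  Sρ₁ : S ρ₁ c₁ ≡ true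
  Sρ₁ = trans (S-other-row c₁ (<⇒≢ ρ₁<r₁) (<⇒≢ ρ₁<r₂)) (proj₁ (proj₂ nearest₁))

  Sρ₂ : S ρ₂ c₂ ≡ true
  Sρ₂ = trans (S-other-row c₂ (<⇒≢ ρ₂<r₁) (<⇒≢ ρ₂<r₂)) (proj₁ (proj₂ nearest₂))

  column₁-above-r₂ : ∀ {r} → U r c₁ ≡ true → r ≢ r₁ → r < r₂
  column₁-above-r₂ {r} u r≢r₁ with <-cmp ρ₁ r
  ... | tri< ρ₁<r _ _ = ⊥-elim (not-¬ u (column₁-empty r ρ₁<r r≢r₁))
  ... | tri≈ _ refl _ = ρ₁<r₂
  ... | tri> _ _ r<ρ₁ = <-trans r<ρ₁ ρ₁<r₂

  column₂-above-r₂ : ∀ {r} → U r c₂ ≡ true → r ≢ r₂ → r < r₂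
  column₂-above-r₂ {r} u r≢r₂ with <-cmp ρ₂ r
  ... | tri< ρ₂<r _ _ = ⊥-elim (not-¬ u (column₂-empty r ρ₂<r r≢r₂))
  ... | tri≈ _ refl _ = ρ₂<r₂
  ... | tri> _ _ r<ρ₂ = <-trans r<ρ₂ ρ₂<r₂

  module _ {r : Fin n} (r≢r₁ : r ≢ r₁) (r≢r₂ : r ≢ r₂) where

    dotLeft-other-row : ∀ c → dotLeft S r c ≡ dotLeft U r c
    dotLeft-other-row c = dotAbove-cong (S ᵀ) (U ᵀ) {c} {r} {r} λ c' _ → S-other-row c' r≢r₁ r≢r₂

    dotRight-other-row : ∀ c → dotRight S r c ≡ dotRight U r c
    dotRight-other-row c = dotBelow-cong (S ᵀ) (U ᵀ) {c} {r} {r} λ c' _ → S-other-row c' r≢r₁ r≢r₂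

    -- a dot in column c₁ or c₂ outside rows r₁, r₂ lies above both of them
    dotAbove-other-row : ∀ {c} → U r c ≡ true → dotAbove S r c ≡ dotAbove U r c
    dotAbove-other-row {c} u with ≡-or-≢ c c₁ | ≡-or-≢ c c₂
    ... | inj₁ refl | _ = dotAbove-cong S U {r} λ r' r'<r →
          let r'<r₂ = <-trans r'<r (column₁-above-r₂ u r≢r₁)
          in S-other-row c (<⇒≢ (<-trans r'<r₂ r₂<r₁)) (<⇒≢ r'<r₂)
    ... | inj₂ _ | inj₁ refl = dotAbove-cong S U {r} λ r' r'<r →
          let r'<r₂ = <-trans r'<r (column₂-above-r₂ u r≢r₂)
          in S-other-row c (<⇒≢ (<-trans r'<r₂ r₂<r₁)) (<⇒≢ r'<r₂)
    ... | inj₂ c≢c₁ | inj₂ c≢c₂ = dotAbove-cong S U {r} λ r' _ → S-other-column r' c≢c₁ c≢c₂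

    dotBelow-other-row : ∀ {c} → U r c ≡ true → dotBelow S r c ≡ dotBelow U r c
    dotBelow-other-row {c} u with ≡-or-≢ c c₁ | ≡-or-≢ c c₂
    ... | inj₁ refl | _ = let r<r₂ = column₁-above-r₂ u r≢r₁ in
          trans (dotBelow-true⁺ S r₂ r<r₂ S₂₁) (sym (dotBelow-true⁺ U r₁ (<-trans r<r₂ r₂<r₁) U₁₁))
    ... | inj₂ _ | inj₁ refl = let r<r₂ = column₂-above-r₂ u r≢r₂ in
          trans (dotBelow-true⁺ S r₁ (<-trans r<r₂ r₂<r₁) S₁₂) (sym (dotBelow-true⁺ U r₂ r<r₂ U₂₂))
    ... | inj₂ c≢c₁ | inj₂ c≢c₂ = dotBelow-cong S U {r} λ r' _ → S-other-column r' c≢c₁ c≢c₂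

  dotLeft-S₁₂ : dotLeft S r₁ c₂ ≡ false
  dotLeft-S₁₂ = dotAbove-false⁺ (S ᵀ) {c₂} {r₁} λ c c<c₂ → trans (S-row₁ c) (≡ᶠ-false (<⇒≢ c<c₂))

  dotRight-S₁₂ : dotRight S r₁ c₂ ≡ false
  dotRight-S₁₂ = dotBelow-false⁺ (S ᵀ) {c₂} {r₁} λ c c₂<c → trans (S-row₁ c) (≡ᶠ-false (≢-sym (<⇒≢ c₂<c)))

  dotBelow-S₁₂ : dotBelow S r₁ c₂ ≡ false
  dotBelow-S₁₂ = dotBelow-false⁺ S {r₁} {c₂} λ j r₁<j →
    let j≢r₁ = ≢-sym (<⇒≢ r₁<j) ; j≢r₂ = ≢-sym (<⇒≢ (<-trans r₂<r₁ r₁<j))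
    in trans (S-other-row c₂ j≢r₁ j≢r₂) (column₂-empty j (<-trans ρ₂<r₁ r₁<j) j≢r₂)

  dotLeft-S₂₁ : dotLeft S r₂ c₁ ≡ false
  dotLeft-S₂₁ = dotAbove-false⁺ (S ᵀ) {c₁} {r₂} λ c c<c₁ → trans (S-row₂ c) (≡ᶠ-false (<⇒≢ c<c₁))

  dotRight-S₂₁ : dotRight S r₂ c₁ ≡ false
  dotRight-S₂₁ = dotBelow-false⁺ (S ᵀ) {c₁} {r₂} λ c c₁<c → trans (S-row₂ c) (≡ᶠ-false (≢-sym (<⇒≢ c₁<c)))

  dotBelow-S₂₁ : dotBelow S r₂ c₁ ≡ false
  dotBelow-S₂₁ = dotBelow-false⁺ S {r₂} {c₁} below
    where
    below : ∀ j → r₂ < j → S j c₁ ≡ false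
    below j r₂<j with ≡-or-≢ j r₁
    ... | inj₁ refl = S₁₁
    ... | inj₂ j≢r₁ = let j≢r₂ = ≢-sym (<⇒≢ r₂<j) in
          trans (S-other-row c₁ j≢r₁ j≢r₂) (column₁-empty j (<-trans ρ₁<r₂ r₂<j) j≢r₁)

  S-leaf₁₂ : isLeaf S r₁ c₂ ≡ true
  S-leaf₁₂ = isLeaf-true⁺ S S₁₂ dotBelow-S₁₂ dotRight-S₁₂

  S-leaf₂₁ : isLeaf S r₂ c₁ ≡ true
  S-leaf₂₁ = isLeaf-true⁺ S S₂₁ dotBelow-S₂₁ dotRight-S₂₁

  S-leftLeaf₁₂ : isLeftLeaf S r₁ c₂ ≡ true
  S-leftLeaf₁₂ = ∧-true S-leaf₁₂ (dotAbove-true⁺ S ρ₂ ρ₂<r₁ Sρ₂)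

  S-leftLeaf₂₁ : isLeftLeaf S r₂ c₁ ≡ true
  S-leftLeaf₂₁ = ∧-true S-leaf₂₁ (dotAbove-true⁺ S ρ₁ ρ₁<r₂ Sρ₁)

  private
    in-row₁ : ∀ {c} → S r₁ c ≡ true → c ≡ c₂
    in-row₁ {c} d = ≡ᶠ-true⁻ {i = c} (trans (sym (S-row₁ c)) d)

    in-row₂ : ∀ {c} → S r₂ c ≡ true → c ≡ c₁
    in-row₂ {c} d = ≡ᶠ-true⁻ {i = c} (trans (sym (S-row₂ c)) d)

    r₁≢0 : toℕ r₁ ≢ 0
    r₁≢0 e = ℕ.n≮0 (subst (toℕ r₂ ℕ.<_) e r₂<r₁)

    r₂≢0 : toℕ r₂ ≢ 0
    r₂≢0 e = ℕ.n≮0 (subst (toℕ ρ₁ ℕ.<_) e ρ₁<r₂)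

    open IsCNAT cn using (nat; complete)

  switch-isNAT : IsNAT S
  switch-isNAT = record
    { root = λ r c r≡0 c≡0 → trans (S-other-row c (λ { refl → r₁≢0 r≡0 }) (λ { refl → r₂≢0 r≡0 }))
                                   (IsNAT.root nat r c r≡0 c≡0)
    ; parent = parent
    ; rowDot = rowDot
    ; colDot = colDot }
    where
    parent : ∀ r c → S r c ≡ true → ¬ (toℕ r ≡ 0 × toℕ c ≡ 0) → (dotAbove S r c xor dotLeft S r c) ≡ true
    parent r c d nonroot with ≡-or-≢ r r₁ | ≡-or-≢ r r₂
    ... | inj₁ refl | _ rewrite in-row₁ d | dotAbove-true⁺ S ρ₂ ρ₂<r₁ Sρ₂ | dotLeft-S₁₂ = refl
    ... | inj₂ _ | inj₁ refl rewrite in-row₂ d | dotAbove-true⁺ S ρ₁ ρ₁<r₂ Sρ₁ | dotLeft-S₂₁ = refl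
    ... | inj₂ r≢r₁ | inj₂ r≢r₂ =
      let u = trans (sym (S-other-row c r≢r₁ r≢r₂)) d in
      trans (cong₂ _xor_ (dotAbove-other-row r≢r₁ r≢r₂ u) (dotLeft-other-row r≢r₁ r≢r₂ c))
            (IsNAT.parent nat r c u nonroot)
    rowDot : ∀ r → ∃[ c ] S r c ≡ true
    rowDot r with ≡-or-≢ r r₁ | ≡-or-≢ r r₂
    ... | inj₁ refl | _ = c₂ , S₁₂
    ... | inj₂ _ | inj₁ refl = c₁ , S₂₁
    ... | inj₂ r≢r₁ | inj₂ r≢r₂ = let (c , u) = IsNAT.rowDot nat r in c , trans (S-other-row c r≢r₁ r≢r₂) u
    colDot : ∀ c → ∃[ r ] S r c ≡ true
    colDot c with ≡-or-≢ c c₁ | ≡-or-≢ c c₂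
    ... | inj₁ refl | _ = r₂ , S₂₁
    ... | inj₂ _ | inj₁ refl = r₁ , S₁₂
    ... | inj₂ c≢c₁ | inj₂ c≢c₂ = let (r , u) = IsNAT.colDot nat c in r , trans (S-other-column r c≢c₁ c≢c₂) u

  switch-isCNAT : IsCNAT S
  switch-isCNAT = record { nat = switch-isNAT ; complete = complete′ }
    where
    complete′ : ∀ r c → S r c ≡ true → (dotBelow S r c ∧ dotRight S r c) ∨ (not (dotBelow S r c) ∧ not (dotRight S r c)) ≡ true
    complete′ r c d with ≡-or-≢ r r₁ | ≡-or-≢ r r₂
    ... | inj₁ refl | _ rewrite in-row₁ d | dotBelow-S₁₂ | dotRight-S₁₂ = refl
    ... | inj₂ _ | inj₁ refl rewrite in-row₂ d | dotBelow-S₂₁ | dotRight-S₂₁ = refl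
    ... | inj₂ r≢r₁ | inj₂ r≢r₂ =
      let u = trans (sym (S-other-row c r≢r₁ r≢r₂)) d in
      trans (cong₂ (λ b d → (b ∧ d) ∨ (not b ∧ not d)) (dotBelow-other-row r≢r₁ r≢r₂ u) (dotRight-other-row r≢r₁ r≢r₂ c))
            (complete r c u)

  switch-switch : switch S (r₁ , c₂) (r₂ , c₁) ≋ U
  switch-switch r c with ≡-or-≢ r r₁ | ≡-or-≢ r r₂
  ... | inj₁ refl | _ rewrite ≡ᶠ-refl r | ≡ᶠ-false r₁≢r₂ with ≡-or-≢ c c₁
  ...   | inj₁ refl rewrite ≡ᶠ-refl c = sym U₁₁
  ...   | inj₂ c≢c₁ rewrite ≡ᶠ-false c≢c₁ with ≡-or-≢ c c₂
  ...     | inj₁ refl rewrite ≡ᶠ-refl c = sym (row₁-empty c c≢c₁)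
  ...     | inj₂ c≢c₂ rewrite ≡ᶠ-false c≢c₂ = refl
  switch-switch r c | inj₂ _ | inj₁ refl rewrite ≡ᶠ-refl r | ≡ᶠ-false (≢-sym r₁≢r₂) with ≡-or-≢ c c₂
  ...   | inj₁ refl rewrite ≡ᶠ-refl c = sym U₂₂
  ...   | inj₂ c≢c₂ rewrite ≡ᶠ-false c≢c₂ with ≡-or-≢ c c₁
  ...     | inj₁ refl rewrite ≡ᶠ-refl c = sym (row₂-empty c c≢c₂)
  ...     | inj₂ c≢c₁ rewrite ≡ᶠ-false c≢c₁ = refl
  switch-switch r c | inj₂ r≢r₁ | inj₂ r≢r₂ rewrite ≡ᶠ-false r≢r₁ | ≡ᶠ-false r≢r₂ = refl

  private
    no-leaf : ∀ (V : Grid n) r c → V r c ≡ false → isLeaf V r c ≡ false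
    no-leaf V r c e rewrite e = refl

    no-leftLeaf : ∀ (V : Grid n) r c → V r c ≡ false → isLeftLeaf V r c ≡ false
    no-leftLeaf V r c e rewrite e = refl

    no-rightLeaf : ∀ (V : Grid n) r c → V r c ≡ false → isRightLeaf V r c ≡ false
    no-rightLeaf V r c e rewrite e = refl

  module _ {r : Fin n} (r≢r₁ : r ≢ r₁) (r≢r₂ : r ≢ r₂) where

    isLeaf-other-row : ∀ c → isLeaf S r c ≡ isLeaf U r c
    isLeaf-other-row c with true-or-false (U r c)
    ... | inj₂ u = trans (no-leaf S r c (trans (S-other-row c r≢r₁ r≢r₂) u)) (sym (no-leaf U r c u))
    ... | inj₁ u = cong₂ _∧_ (S-other-row c r≢r₁ r≢r₂)
                     (cong₂ (λ b d → not b ∧ not d) (dotBelow-other-row r≢r₁ r≢r₂ u) (dotRight-other-row r≢r₁ r≢r₂ c))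

    isLeftLeaf-other-row : ∀ c → isLeftLeaf S r c ≡ isLeftLeaf U r c
    isLeftLeaf-other-row c with true-or-false (U r c)
    ... | inj₂ u = trans (no-leftLeaf S r c (trans (S-other-row c r≢r₁ r≢r₂) u)) (sym (no-leftLeaf U r c u))
    ... | inj₁ u = cong₂ _∧_ (isLeaf-other-row c) (dotAbove-other-row r≢r₁ r≢r₂ u)

    isRightLeaf-other-row : ∀ c → isRightLeaf S r c ≡ isRightLeaf U r c
    isRightLeaf-other-row c = cong₂ _∧_ (isLeaf-other-row c) (dotLeft-other-row r≢r₁ r≢r₂ c)

    parentCol-other-row : ∀ c → parentCol S r c ≡ parentCol U r c
    parentCol-other-row c = parentRow-cong (S ᵀ) (U ᵀ) {c} {r} {r} λ c' _ → S-other-row c' r≢r₁ r≢r₂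

  isLeaf-switch : ∀ r c → isLeaf S r c ≡ isLeaf U (transpose r₁ r₂ r) c
  isLeaf-switch r c with ≡-or-≢ r r₁ | ≡-or-≢ r r₂
  ... | inj₁ refl | _ rewrite transpose-left r₁ r₂ with ≡-or-≢ c c₂
  ...   | inj₁ refl = trans S-leaf₁₂ (sym (∧-trueˡ ll₂))
  ...   | inj₂ c≢c₂ = trans (no-leaf S r₁ c (trans (S-row₁ c) (≡ᶠ-false c≢c₂))) (sym (no-leaf U r₂ c (row₂-empty c c≢c₂)))
  isLeaf-switch r c | inj₂ _ | inj₁ refl rewrite transpose-right r₁ r₂ with ≡-or-≢ c c₁
  ...   | inj₁ refl = trans S-leaf₂₁ (sym (∧-trueˡ ll₁))
  ...   | inj₂ c≢c₁ = trans (no-leaf S r₂ c (trans (S-row₂ c) (≡ᶠ-false c≢c₁))) (sym (no-leaf U r₁ c (row₁-empty c c≢c₁)))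
  isLeaf-switch r c | inj₂ r≢r₁ | inj₂ r≢r₂ rewrite transpose-other r≢r₁ r≢r₂ = isLeaf-other-row r≢r₁ r≢r₂ c

  private
    no-rightLeaf-in-row₁ : ∀ c → isRightLeaf U r₁ c ≡ false
    no-rightLeaf-in-row₁ c with ≡-or-≢ c c₁
    ... | inj₁ refl = trans (cong (isLeaf U r₁ c ∧_) (leftLeaf-dotLeft U cn ll₁)) (∧-zeroʳ _)
    ... | inj₂ c≢c₁ = no-rightLeaf U r₁ c (row₁-empty c c≢c₁)

    no-rightLeaf-in-row₂ : ∀ c → isRightLeaf U r₂ c ≡ false
    no-rightLeaf-in-row₂ c with ≡-or-≢ c c₂
    ... | inj₁ refl = trans (cong (isLeaf U r₂ c ∧_) (leftLeaf-dotLeft U cn ll₂)) (∧-zeroʳ _)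
    ... | inj₂ c≢c₂ = no-rightLeaf U r₂ c (row₂-empty c c≢c₂)

  isRightLeaf-switch : ∀ r c → isRightLeaf S r c ≡ isRightLeaf U r c
  isRightLeaf-switch r c with ≡-or-≢ r r₁ | ≡-or-≢ r r₂
  ... | inj₁ refl | _ with ≡-or-≢ c c₂
  ...   | inj₁ refl = trans (cong (isLeaf S r c ∧_) dotLeft-S₁₂) (trans (∧-zeroʳ _) (sym (no-rightLeaf-in-row₁ c)))
  ...   | inj₂ c≢c₂ = trans (no-rightLeaf S r₁ c (trans (S-row₁ c) (≡ᶠ-false c≢c₂))) (sym (no-rightLeaf-in-row₁ c))
  isRightLeaf-switch r c | inj₂ _ | inj₁ refl with ≡-or-≢ c c₁
  ...   | inj₁ refl = trans (cong (isLeaf S r c ∧_) dotLeft-S₂₁) (trans (∧-zeroʳ _) (sym (no-rightLeaf-in-row₂ c)))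
  ...   | inj₂ c≢c₁ = trans (no-rightLeaf S r₂ c (trans (S-row₂ c) (≡ᶠ-false c≢c₁))) (sym (no-rightLeaf-in-row₂ c))
  isRightLeaf-switch r c | inj₂ r≢r₁ | inj₂ r≢r₂ = isRightLeaf-other-row r≢r₁ r≢r₂ c

  -- right leaves live outside rows r₁, r₂, where S and U agree
  interactingRight-switch : ∀ x y → interactingRight S x y ≡ interactingRight U x y
  interactingRight-switch (r , c) (r' , c') =
    guarded (isRightLeaf-switch r c) (isRightLeaf-switch r' c') same-parent same-parent
    where
    guarded : ∀ {a a' b b' p p' q q'} → a ≡ a' → b ≡ b' → (a' ≡ true → p ≡ p') → (b' ≡ true → q ≡ q') →
              a ∧ (b ∧ (p ∨ q)) ≡ a' ∧ (b' ∧ (p' ∨ q'))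
    guarded {a' = false} refl _ _ _ = refl
    guarded {a' = true} {b' = false} refl refl _ _ = refl
    guarded {a' = true} {b' = true} refl refl hp hq = cong₂ _∨_ (hp refl) (hq refl)
    same-parent : ∀ {r c a b} → isRightLeaf U r c ≡ true → between S (parentCol S r c) a b ≡ between U (parentCol U r c) a b
    same-parent {r} {c} {a} {b} rl =
      trans (cong (λ m → between S m a b) (parentCol-other-row r≢r₁ r≢r₂ c)) (between-indep S U (parentCol U r c) a b)
      where
      r≢r₁ : r ≢ r₁
      r≢r₁ refl = not-¬ rl (no-rightLeaf-in-row₁ c)
      r≢r₂ : r ≢ r₂
      r≢r₂ refl = not-¬ rl (no-rightLeaf-in-row₂ c)

  isLeaf-switch-columns : ∀ r c → isLeaf S r c ≡ isLeaf U r (transpose c₁ c₂ c)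
  isLeaf-switch-columns r c with ≡-or-≢ c c₁ | ≡-or-≢ c c₂
  ... | inj₁ refl | _ rewrite transpose-left c₁ c₂ =
    trans (isLeaf-in-column S S-leaf₂₁ r) (sym (isLeaf-in-column U (∧-trueˡ ll₂) r))
  ... | inj₂ _ | inj₁ refl rewrite transpose-right c₁ c₂ =
    trans (isLeaf-in-column S S-leaf₁₂ r) (sym (isLeaf-in-column U (∧-trueˡ ll₁) r))
  ... | inj₂ c≢c₁ | inj₂ c≢c₂ rewrite transpose-other c≢c₁ c≢c₂ with ≡-or-≢ r r₁ | ≡-or-≢ r r₂
  ...   | inj₁ refl | _ = trans (no-leaf S r₁ c (trans (S-row₁ c) (≡ᶠ-false c≢c₂))) (sym (no-leaf U r₁ c (row₁-empty c c≢c₁)))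
  ...   | inj₂ _ | inj₁ refl = trans (no-leaf S r₂ c (trans (S-row₂ c) (≡ᶠ-false c≢c₁))) (sym (no-leaf U r₂ c (row₂-empty c c≢c₂)))
  ...   | inj₂ r≢r₁ | inj₂ r≢r₂ = isLeaf-other-row r≢r₁ r≢r₂ c

  parentRow-S₁₂ : parentRow S r₁ c₂ ≡ just ρ₂
  parentRow-S₁₂ = parentRow-just⁺ S ρ₂ (ρ₂<r₁ , Sρ₂ , gap)
    where
    gap : ∀ j → ρ₂ < j → j < r₁ → S j c₂ ≡ false
    gap j ρ₂<j j<r₁ with ≡-or-≢ j r₂
    ... | inj₁ refl = S₂₂
    ... | inj₂ j≢r₂ = trans (S-other-row c₂ (<⇒≢ j<r₁) j≢r₂) (column₂-empty j ρ₂<j j≢r₂)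

  switch-long : LongLeftLeaf S r₁ c₂
  switch-long = S-leftLeaf₁₂ , trans (cong (λ m → adjacent S m r₁) parentRow-S₁₂) (¬-not not-adjacent)
    where
    not-adjacent : (suc (toℕ ρ₂) ≡ᵇ toℕ r₁) ≢ true
    not-adjacent e = <-irrefl refl (subst (ℕ._< toℕ r₁) (ℕ.≡ᵇ⇒≡ _ _ (Equivalence.from T-≡ e)) (ℕ.≤-<-trans ρ₂<r₂ r₂<r₁))

  switch-interacting : interactingLeft S (r₁ , c₂) (r₂ , c₁) ≡ true
  switch-interacting = interactingLeft-true⁺ S ρ₂ S-leftLeaf₁₂ S-leftLeaf₂₁ parentRow-S₁₂ ρ₂<r₂ r₂<r₁

  private
    leftLeaf-to-U : ∀ {r c} → isLeftLeaf S r c ≡ true → r ≢ r₁ → r ≢ r₂ →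
                    isLeftLeaf U r c ≡ true × parentRow S r c ≡ parentRow U r c
    leftLeaf-to-U {r} {c} ll r≢r₁ r≢r₂ = llᵁ , parentRow-cong S U {r} λ r' _ → S-other-column r' c≢c₁ c≢c₂
      where
      llᵁ : isLeftLeaf U r c ≡ true
      llᵁ = trans (sym (isLeftLeaf-other-row r≢r₁ r≢r₂ c)) ll
      c≢c₁ : c ≢ c₁
      c≢c₁ refl = r≢r₁ (leaf-unique-in-column U (∧-trueˡ llᵁ) (∧-trueˡ ll₁))
      c≢c₂ : c ≢ c₂
      c≢c₂ refl = r≢r₂ (leaf-unique-in-column U (∧-trueˡ llᵁ) (∧-trueˡ ll₂))

    leftLeaf-row-to-U : ∀ {r c} → isLeftLeaf S r c ≡ true → ∃[ c' ] isLeftLeaf U r c' ≡ true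
    leftLeaf-row-to-U {r} {c} ll with ≡-or-≢ r r₁ | ≡-or-≢ r r₂
    ... | inj₁ refl | _ = c₁ , ll₁
    ... | inj₂ _ | inj₁ refl = c₂ , ll₂
    ... | inj₂ r≢r₁ | inj₂ r≢r₂ = c , proj₁ (leftLeaf-to-U ll r≢r₁ r≢r₂)

    below-r₁ : ∀ {r c} → isLeftLeaf S r c ≡ true → r₁ < r →
               isLeftLeaf U r c ≡ true × parentRow S r c ≡ parentRow U r c
    below-r₁ ll r₁<r = leftLeaf-to-U ll (≢-sym (<⇒≢ r₁<r)) (≢-sym (<⇒≢ (<-trans r₂<r₁ r₁<r)))

  lexMax-switch : LexMaxLeft U (r₁ , c₁) (r₂ , c₂) → LexMaxLeft S (r₁ , c₂) (r₂ , c₁)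
  lexMax-switch max (rx , cx) (ry , cy) i = no-higher-first , no-higher-second
    where
    llx : isLeftLeaf S rx cx ≡ true
    llx = proj₁ (interactingLeft-true⁻ S {rx} {cx} {ry} {cy} i)
    lly : isLeftLeaf S ry cy ≡ true
    lly = proj₁ (proj₂ (interactingLeft-true⁻ S {rx} {cx} {ry} {cy} i))
    straddle : between S (parentRow S rx cx) ry rx ≡ true ⊎ between S (parentRow S ry cy) rx ry ≡ true
    straddle = proj₂ (proj₂ (interactingLeft-true⁻ S {rx} {cx} {ry} {cy} i))

    no-higher-first : ¬ r₁ < rx
    no-higher-first r₁<rx with straddle
    ... | inj₁ b =
      let (p , pr , p<ry , ry<rx) = between-true⁻ S (parentRow S rx cx) ry rx b
          (llxᵁ , same) = below-r₁ llx r₁<rx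
          (c' , llyᵁ) = leftLeaf-row-to-U lly
      in proj₁ (max (rx , cx) (ry , c') (interactingLeft-true⁺ U p llxᵁ llyᵁ (trans (sym same) pr) p<ry ry<rx)) r₁<rx
    ... | inj₂ b =
      let (p , pr , p<rx , rx<ry) = between-true⁻ S (parentRow S ry cy) rx ry b
          r₁<ry = <-trans r₁<rx rx<ry
          (llyᵁ , same) = below-r₁ lly r₁<ry
          (c' , llxᵁ) = leftLeaf-row-to-U llx
      in proj₁ (max (ry , cy) (rx , c') (interactingLeft-true⁺ U p llyᵁ llxᵁ (trans (sym same) pr) p<rx rx<ry)) r₁<ry

    no-higher-second : rx ≡ r₁ → ¬ r₂ < ry
    no-higher-second refl r₂<ry with leaf-unique-in-row S {r₁} {cx} {c₂} (∧-trueˡ llx) S-leaf₁₂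
    ... | refl with straddle
    ...   | inj₁ b =
      let (_ , _ , _ , ry<r₁) = between-true⁻ S (parentRow S r₁ c₂) ry r₁ b
          (llyᵁ , _) = leftLeaf-to-U lly (<⇒≢ ry<r₁) (≢-sym (<⇒≢ r₂<ry))
      in proj₂ (max (r₁ , c₁) (ry , cy) (interactingLeft-true⁺ U ρ₁ ll₁ llyᵁ pr₁ (<-trans ρ₁<r₂ r₂<ry) ry<r₁)) refl r₂<ry
    ...   | inj₂ b =
      let (p , pr , p<r₁ , r₁<ry) = between-true⁻ S (parentRow S ry cy) r₁ ry b
          (llyᵁ , same) = below-r₁ lly r₁<ry
      in proj₂ (max (r₁ , c₁) (ry , cy)
           (interactingLeft-sym U (ry , cy) (r₁ , c₁) (interactingLeft-true⁺ U p llyᵁ ll₁ (trans (sym same) pr) p<r₁ r₁<ry)))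
           refl r₂<ry

module ParentMap (U : Grid n) (cn : IsCNAT U) (no-interacting : ∀ x y → interactingLeft U x y ≡ false) where

  hasLeftLeaf hasRightLeaf : Fin n → Bool
  hasLeftLeaf r = anyF (isLeftLeaf U r)
  hasRightLeaf r = anyF (isRightLeaf U r)

  -- junk value r when row r has no left leaf
  parent : Fin n → Fin n
  parent r = fromMaybe r (findLast (λ c → if isLeftLeaf U r c then parentRow U r c else nothing))

  parentRow-leftLeaf : ∀ {r c} → isLeftLeaf U r c ≡ true → parentRow U r c ≡ just (parent r)
  parentRow-leftLeaf {r} {c} ll with parentRow-exists U {r} {c} (∧-trueʳ {isLeaf U r c} ll)
  ... | ρ , pr = trans pr (cong (just ∘ fromMaybe r) (sym (findLast-just⁺ _ c (trans (if-true ll) pr , later))))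
    where
    later : ∀ c' → c < c' → (if isLeftLeaf U r c' then parentRow U r c' else nothing) ≡ nothing
    later c' c<c' = if-false (¬-not λ ll' → <-irrefl (leaf-unique-in-row U (∧-trueˡ ll) (∧-trueˡ ll')) c<c')

  parent-hasRightLeaf : ∀ {r c} → isLeftLeaf U r c ≡ true → hasRightLeaf (parent r) ≡ true
  parent-hasRightLeaf {r} {c} ll with parentRow-just⁻ U {r} {c} (parentRow-leftLeaf ll) | leaf-in-row U cn (parent r)
  ... | ρ<r , uρ , _ | f , lf = anyF-true⁺ _ f (∧-true lf (dotAbove-true⁺ (U ᵀ) {f} {parent r} c c<f uρ))
    where
    c<f : c < f
    c<f with <-cmp c f | isLeaf-true⁻ U lf
    ... | tri< c<f _ _ | _ = c<f
    ... | tri≈ _ refl _ | _ , below , _ = ⊥-elim (not-¬ (dotBelow-true⁺ U r ρ<r (proj₁ (isLeaf-true⁻ U (∧-trueˡ ll)))) below)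
    ... | tri> _ _ f<c | _ , _ , right = ⊥-elim (not-¬ uρ (dotBelow-false⁻ (U ᵀ) right c f<c))

  parent-injective : ∀ r r' → hasLeftLeaf r ≡ true → hasLeftLeaf r' ≡ true → parent r ≡ parent r' → r ≡ r'
  parent-injective r r' h h' same with anyF-true⁻ _ h | anyF-true⁻ _ h'
  ... | c , ll | c' , ll' with <-cmp r r'
  ...   | tri≈ _ r≡r' _ = r≡r'
  ...   | tri< r<r' _ _ = ⊥-elim (not-¬ (interactingLeft-true⁺ U (parent r') ll' ll (parentRow-leftLeaf ll')
           (subst (_< r) same (proj₁ (parentRow-just⁻ U {r} {c} (parentRow-leftLeaf ll)))) r<r')
           (no-interacting (r' , c') (r , c)))
  ...   | tri> _ _ r'<r = ⊥-elim (not-¬ (interactingLeft-true⁺ U (parent r) ll ll' (parentRow-leftLeaf ll)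
           (subst (_< r') (sym same) (proj₁ (parentRow-just⁻ U {r'} {c'} (parentRow-leftLeaf ll')))) r'<r)
           (no-interacting (r , c) (r' , c')))

  leftLeafRows≤rightLeafRows : (E : Fin n → Bool) → (∀ r c → isLeftLeaf U r c ≡ true → E (parent r) ≡ true) →
                               count hasLeftLeaf ≤ count (λ r → hasRightLeaf r ∧ E r)
  leftLeafRows≤rightLeafRows E avoids = count-injection hasLeftLeaf (λ r → hasRightLeaf r ∧ E r) parent
    (λ r h → let (c , ll) = anyF-true⁻ _ h in ∧-true (parent-hasRightLeaf ll) (avoids r c ll)) parent-injective

module _ (U : Grid n) where

  private
    at-most-one-leaf : (L : Fin n → Fin n → Bool) → (∀ r c → L r c ≡ true → isLeaf U r c ≡ true) →
      count (λ r → anyF (L r)) ≡ count (λ c → anyF (λ r → L r c))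
    at-most-one-leaf L leaf = count-rows≡count-cols L
      (λ r c c' l l' → leaf-unique-in-row U (leaf r c l) (leaf r c' l'))
      (λ c r r' l l' → leaf-unique-in-column U (leaf r c l) (leaf r' c l'))

  leftLeafRows≡leftLeafColumns : count (λ r → anyF (isLeftLeaf U r)) ≡ count (λ c → anyF (λ r → isLeftLeaf U r c))
  leftLeafRows≡leftLeafColumns = at-most-one-leaf (isLeftLeaf U) (λ _ _ → ∧-trueˡ)

  rightLeafRows≡rightLeafColumns : count (λ r → anyF (isRightLeaf U r)) ≡ count (λ c → anyF (λ r → isRightLeaf U r c))
  rightLeafRows≡rightLeafColumns = at-most-one-leaf (isRightLeaf U) (λ _ _ → ∧-trueˡ)

-- the parent map of Uᵀ injects the columns holding right leaves into those holding left leaves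
rightLeafRows≤leftLeafRows : (U : Grid n) → IsCNAT U → (∀ x y → interactingRight U x y ≡ false) →
  count (λ r → anyF (isRightLeaf U r)) ≤ count (λ r → anyF (isLeftLeaf U r))
rightLeafRows≤leftLeafRows U cn no-interacting = begin
  count (λ r → anyF (isRightLeaf U r))        ≡⟨ rightLeafRows≡rightLeafColumns U ⟩
  count (λ c → anyF (λ r → isRightLeaf U r c)) ≡⟨ sumF-cong (λ c → cong ind (anyF-cong λ r → isLeftLeaf-ᵀ U c r)) ⟨
  count Uᵀ.hasLeftLeaf                         ≤⟨ Uᵀ.leftLeafRows≤rightLeafRows (λ _ → true) (λ _ _ _ → refl) ⟩
  count (λ c → Uᵀ.hasRightLeaf c ∧ true)       ≡⟨ sumF-cong (λ c → cong ind (trans (∧-identityʳ _)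
                                                                  (anyF-cong λ r → isRightLeaf-ᵀ U c r))) ⟩
  count (λ c → anyF (λ r → isLeftLeaf U r c))  ≡⟨ leftLeafRows≡leftLeafColumns U ⟨
  count (λ r → anyF (isLeftLeaf U r))          ∎
  where
  open ℕ.≤-Reasoning
  no-interactingᵀ : ∀ x y → interactingLeft (U ᵀ) x y ≡ false
  no-interactingᵀ (a , b) (c , d) = trans (interactingLeft-ᵀ U a b c d) (no-interacting (b , a) (d , c))
  module Uᵀ = ParentMap (U ᵀ) (IsCNAT-ᵀ U cn) no-interactingᵀ

module NoInteracting (U : Grid n) (cn : IsCNAT U) (noL : ∀ x y → interactingLeft U x y ≡ false)
                     (noR : ∀ x y → interactingRight U x y ≡ false) where
  open ParentMap U cn noL

  -- The leaf of row s is a left leaf interacting with (r , c), or a right leaf; in the latter case the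
  -- parent map misses the right-leaf row s, so there are more right-leaf rows than left-leaf rows.
  row-between-parent-and-leftLeaf : ∀ {r c ρ s} → isLeftLeaf U r c ≡ true → parentRow U r c ≡ just ρ →
                                    ρ < s → s < r → ⊥
  row-between-parent-and-leftLeaf {r} {c} {ρ} {s} ll pr ρ<s s<r with leaf-in-row U cn s
  ... | f , lf with leaf-left-or-right U cn lf (λ s≡0 → ℕ.n≮0 (subst (toℕ ρ ℕ.<_) (proj₁ s≡0) ρ<s))
  ... | inj₁ ll-s = not-¬ (interactingLeft-true⁺ U ρ ll ll-s pr ρ<s s<r) (noL (r , c) (s , f))
  ... | inj₂ rl-s = ℕ.<-irrefl refl (ℕ.≤-trans more-right (rightLeafRows≤leftLeafRows U cn noR))
    where
    parent≢s : ∀ r' c' → isLeftLeaf U r' c' ≡ true → not (parent r' ≡ᶠ s) ≡ true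
    parent≢s r' c' ll' = cong not (≡ᶠ-false parent-r'≢s)
      where
      pr' : parentRow U r' c' ≡ just (parent r')
      pr' = parentRow-leftLeaf ll'
      parent-r'≢s : parent r' ≢ s
      parent-r'≢s p≡s with <-cmp r' r
      ... | tri< r'<r _ _ = not-¬ (interactingLeft-true⁺ U ρ ll ll' pr
              (<-trans ρ<s (subst (_< r') p≡s (proj₁ (parentRow-just⁻ U {r'} {c'} pr')))) r'<r) (noL (r , c) (r' , c'))
      ... | tri≈ _ refl _ = <-irrefl (trans (just-injective (trans (sym pr) (parentRow-leftLeaf ll))) p≡s) ρ<s
      ... | tri> _ _ r<r' = not-¬ (interactingLeft-true⁺ U (parent r') ll' ll pr' (subst (_< r) (sym p≡s) s<r) r<r')
              (noL (r' , c') (r , c))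
    more-right : suc (count hasLeftLeaf) ≤ count hasRightLeaf
    more-right = subst (suc (count hasLeftLeaf) ≤_) (sym (count-remove hasRightLeaf s (anyF-true⁺ _ f rl-s)))
                       (s≤s (leftLeafRows≤rightLeafRows (λ i → not (i ≡ᶠ s)) parent≢s))

  no-long-leaf : ∀ {r c} → ¬ LongLeftLeaf U r c
  no-long-leaf {r} {c} (ll , long) with parentRow-exists U {r} {c} (∧-trueʳ {isLeaf U r c} ll)
  ... | ρ , pr = row-between-parent-and-leftLeaf ll pr ρ<s s<r
    where
    ρ<r : ρ < r
    ρ<r = proj₁ (parentRow-just⁻ U {r} {c} pr)
    ρ+1<r : suc (toℕ ρ) ℕ.< toℕ r
    ρ+1<r = ℕ.≤∧≢⇒< ρ<r λ e →
      not-¬ (trans (cong (λ m → adjacent U m r) pr) (Equivalence.to T-≡ (ℕ.≡⇒≡ᵇ _ _ e))) long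
    s : Fin n
    s = fromℕ< (ℕ.<-trans ρ+1<r (toℕ<n r))
    ρ<s : ρ < s
    ρ<s = subst (toℕ ρ ℕ.<_) (sym (toℕ-fromℕ< _)) ℕ.≤-refl
    s<r : s < r
    s<r = subst (ℕ._< toℕ r) (sym (toℕ-fromℕ< _)) ρ+1<r

module LeftCase (T : Grid n) (cn : IsCNAT T) {r₁ c₁ r₂ c₂ : Fin n}
  (max-eq : maxInteractingLeft T ≡ just ((r₁ , c₁) , (r₂ , c₂))) where

  private
    interacting : interactingLeft T (r₁ , c₁) (r₂ , c₂) ≡ true
    interacting = proj₁ (maxInteractingLeft-just⁻ T max-eq)

    lexMax : LexMaxLeft T (r₁ , c₁) (r₂ , c₂)
    lexMax = proj₂ (maxInteractingLeft-just⁻ T max-eq)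

    leftLeaf₁ : isLeftLeaf T r₁ c₁ ≡ true
    leftLeaf₁ = proj₁ (interactingLeft-true⁻ T interacting)

    leftLeaf₂ : isLeftLeaf T r₂ c₂ ≡ true
    leftLeaf₂ = proj₁ (proj₂ (interactingLeft-true⁻ T interacting))

    lower : r₂ < r₁
    lower = lexMax-rows T interacting lexMax

    parent₁ : ∃[ ρ ] parentRow T r₁ c₁ ≡ just ρ × ρ < r₂
    parent₁ = interactingLeft-ordered T interacting lower

    parent₂ : ∃[ ρ ] parentRow T r₂ c₂ ≡ just ρ
    parent₂ = parentRow-exists T {r₂} {c₂} (∧-trueʳ {isLeaf T r₂ c₂} leftLeaf₂)

  open LeftSwitch T cn leftLeaf₁ leftLeaf₂ (proj₁ (proj₂ parent₁)) (proj₂ parent₂) lower (proj₂ (proj₂ parent₁)) public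

  switch-max : maxInteractingLeft S ≡ just ((r₁ , c₂) , (r₂ , c₁))
  switch-max = maxInteractingLeft-just⁺ S _ _ switch-interacting (lexMax-switch lexMax)

  Φ-switch : Φ S ≡ switch S (r₁ , c₂) (r₂ , c₁)
  Φ-switch = Φ-left S (longLeftLeaf⇒¬allShort S switch-long) switch-max

-- The switch of the maximal interacting right leaves of T is the transpose of the switch of the
-- maximal interacting left leaves of Tᵀ.
module RightCase (T : Grid n) (cn : IsCNAT T) {r₁ c₁ r₂ c₂ : Fin n}
  (max-eq : maxInteractingRight T ≡ just ((r₁ , c₁) , (r₂ , c₂))) where

  private
    module Tᵀ = LeftCase (T ᵀ) (IsCNAT-ᵀ T cn) (map-flip²-just⁻ (trans (sym (maxInteractingRight-ᵀ T)) max-eq))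

  S : Grid n
  S = switch T (r₁ , c₁) (r₂ , c₂)

  S≋ : S ≋ Tᵀ.S ᵀ
  S≋ = switch-ᵀ T r₁ c₁ r₂ c₂

  Sᵀ≋ : S ᵀ ≋ Tᵀ.S
  Sᵀ≋ r c = S≋ c r

  c₁≢c₂ : c₁ ≢ c₂
  c₁≢c₂ = Tᵀ.r₁≢r₂

  switch-isCNAT : IsCNAT S
  switch-isCNAT = IsCNAT-≋ S≋ (IsCNAT-ᵀ Tᵀ.S Tᵀ.switch-isCNAT)

  interactingLeft-switch : ∀ x y → interactingLeft S x y ≡ interactingLeft T x y
  interactingLeft-switch (a , b) (c , d) = begin
    interactingLeft S (a , b) (c , d)        ≡⟨ interactingLeft-≋ S≋ (a , b) (c , d) ⟩
    interactingLeft (Tᵀ.S ᵀ) (a , b) (c , d) ≡⟨ interactingLeft-ᵀ Tᵀ.S a b c d ⟩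
    interactingRight Tᵀ.S (b , a) (d , c)    ≡⟨ Tᵀ.interactingRight-switch (b , a) (d , c) ⟩
    interactingRight (T ᵀ) (b , a) (d , c)   ≡⟨ interactingRight-ᵀ T b a d c ⟩
    interactingLeft T (a , b) (c , d)        ∎
    where open ≡-Reasoning

  allShort-switch : allShort S ≡ false
  allShort-switch = longRightLeaf⇒¬allShort S {r₂} {c₁} not-left (LongLeftLeaf-≋ Sᵀ≋ Tᵀ.switch-long)
    where
    not-left : isLeftLeaf S r₂ c₁ ≡ false
    not-left = trans (isLeftLeaf-≋ S≋ r₂ c₁)
      (trans (isLeftLeaf-ᵀ Tᵀ.S r₂ c₁) (trans (cong (isLeaf Tᵀ.S c₁ r₂ ∧_) Tᵀ.dotLeft-S₁₂) (∧-zeroʳ _)))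

  switch-max : maxInteractingRight S ≡ just ((r₂ , c₁) , (r₁ , c₂))
  switch-max = trans (maxInteractingRight-ᵀ S)
    (cong (Maybe.map flip²) (trans (maxInteractingLeft-cong (S ᵀ) Tᵀ.S (interactingLeft-≋ Sᵀ≋)) Tᵀ.switch-max))

  Φ-switch : maxInteractingLeft T ≡ nothing → Φ S ≡ switch S (r₂ , c₁) (r₁ , c₂)
  Φ-switch noL = Φ-right S allShort-switch (trans (maxInteractingLeft-cong S T interactingLeft-switch) noL) switch-max

  switch-switch : switch S (r₂ , c₁) (r₁ , c₂) ≋ T
  switch-switch r c = begin
    switch S (r₂ , c₁) (r₁ , c₂) r c      ≡⟨ switch-ᵀ S r₂ c₁ r₁ c₂ r c ⟩
    switch (S ᵀ) (c₁ , r₂) (c₂ , r₁) c r  ≡⟨ switch-≋ Sᵀ≋ (c₁ , r₂) (c₂ , r₁) c r ⟩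
    switch Tᵀ.S (c₁ , r₂) (c₂ , r₁) c r   ≡⟨ Tᵀ.switch-switch c r ⟩
    T r c                                 ∎
    where open ≡-Reasoning

  isLeaf-switch-columns : ∀ r c → isLeaf S r c ≡ isLeaf T r (transpose c₁ c₂ c)
  isLeaf-switch-columns r c = trans (isLeaf-≋ S≋ r c)
    (trans (isLeaf-ᵀ Tᵀ.S r c) (trans (Tᵀ.isLeaf-switch c r) (isLeaf-ᵀ T (transpose c₁ c₂ c) r)))

Outcome : Grid n → Set
Outcome T = IsCNAT (Φ T) × (Φ (Φ T) ≋ T) × (¬ InA T → sgn (perm (Φ T)) ≡ - sgn (perm T))

module _ (T : Grid n) (cn : IsCNAT T) (not-short : allShort T ≡ false) where

  left-case : ∀ {l₁ l₂} → maxInteractingLeft T ≡ just (l₁ , l₂) → Outcome T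
  left-case {r₁ , c₁} {r₂ , c₂} max-eq rewrite Φ-left T not-short max-eq =
    switch-isCNAT ,
    (λ r c → trans (cong (λ V → V r c) Φ-switch) (switch-switch r c)) ,
    λ _ → trans (sgn-cong (perm-along T S cn (transpose c₁ c₂) isLeaf-switch-columns))
                (sgn-transpose (perm T) (perm-injective T cn) c₁≢c₂)
    where open LeftCase T cn max-eq

  right-case : ∀ {l₁ l₂} → maxInteractingLeft T ≡ nothing → maxInteractingRight T ≡ just (l₁ , l₂) → Outcome T
  right-case {r₁ , c₁} {r₂ , c₂} noL max-eq rewrite Φ-right T not-short noL max-eq =
    switch-isCNAT ,
    (λ r c → trans (cong (λ V → V r c) (Φ-switch noL)) (switch-switch r c)) ,
    λ _ → trans (sgn-cong (perm-along T S cn (transpose c₁ c₂) isLeaf-switch-columns))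
                (sgn-transpose (perm T) (perm-injective T cn) c₁≢c₂)
    where open RightCase T cn max-eq

long-leaf⇒interacting : (T : Grid n) → IsCNAT T → allShort T ≡ false →
  maxInteractingLeft T ≡ nothing → maxInteractingRight T ≡ nothing → ⊥
long-leaf⇒interacting T cn not-short eL eR with ¬allShort⇒longLeaf T not-short
... | _ , _ , inj₁ longL = NoInteracting.no-long-leaf T cn noL noR longL
  where
  noL : ∀ x y → interactingLeft T x y ≡ false
  noL = maxInteractingLeft-nothing⁻ T eL
  noR : ∀ x y → interactingRight T x y ≡ false
  noR = maxInteractingRight-nothing⁻ T eR
... | _ , _ , inj₂ longR = NoInteracting.no-long-leaf (T ᵀ) (IsCNAT-ᵀ T cn) noLᵀ noRᵀ longR
  where
  noLᵀ : ∀ x y → interactingLeft (T ᵀ) x y ≡ false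
  noLᵀ (a , b) (c , d) = trans (interactingLeft-ᵀ T a b c d) (maxInteractingRight-nothing⁻ T eR (b , a) (d , c))
  noRᵀ : ∀ x y → interactingRight (T ᵀ) x y ≡ false
  noRᵀ (a , b) (c , d) = trans (interactingRight-ᵀ T a b c d) (maxInteractingLeft-nothing⁻ T eL (b , a) (d , c))

outcome : (T : Grid n) → IsCNAT T → Outcome T
outcome T cn = by-shortness (allShort T) refl
  where
  by-right : allShort T ≡ false → maxInteractingLeft T ≡ nothing → ∀ m → maxInteractingRight T ≡ m → Outcome T
  by-right not-short noL (just _) eR = right-case T cn not-short noL eR
  by-right not-short noL nothing eR = ⊥-elim (long-leaf⇒interacting T cn not-short noL eR)
  by-left : allShort T ≡ false → ∀ m → maxInteractingLeft T ≡ m → Outcome T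
  by-left not-short (just _) eL = left-case T cn not-short eL
  by-left not-short nothing eL = by-right not-short eL (maxInteractingRight T) refl
  by-shortness : ∀ b → allShort T ≡ b → Outcome T
  by-shortness true short = subst IsCNAT (sym Φ≡T) cn ,
                            (λ r c → trans (cong (λ V → Φ V r c) Φ≡T) (cong (λ V → V r c) Φ≡T)) ,
                            λ notA → ⊥-elim (notA short)
    where
    Φ≡T : Φ T ≡ T
    Φ≡T = Φ-allShort T short
  by-shortness false not-short = by-left not-short (maxInteractingLeft T) refl

proposition5 : (n : ℕ) → 1 ≤ n →
    ((T : Grid n) → IsCNAT T → IsCNAT (Φ T))
    × ((T : Grid n) → IsCNAT T → Φ (Φ T) ≋ T)
    × ((T : Grid n) → IsCNAT T → ¬ InA T → sgn (perm (Φ T)) ≡ - sgn (perm T))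
proposition5 n _ = (λ T cn → proj₁ (outcome T cn)) , (λ T cn → proj₁ (proj₂ (outcome T cn))) ,
                   (λ T cn → proj₂ (proj₂ (outcome T cn)))
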